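{- Let $n\ge1$, $k\ge1$, and $L=(l_1,\dots,l_n)$ with $1\le l_i\le k$. Let $c^{(k)}_L$ be the coefficient of $x_1^{\underline{l_1}}\cdots x_n^{\underline{l_n}}$ in the unique expansion $(x_1\cdots x_n)^{\underline{k}}=\sum_L c^{(k)}_L\, x_1^{\underline{l_1}}\cdots x_n^{\underline{l_n}}$. Then $l_1!\,l_2!\cdots l_n!\,c^{(k)}_L$ equals the number of $k$-conjoint ranking tables of size $l_1\times\cdots\times l_n$. Consequently $c^{(k)}_L=0$ if $\prod_i l_i<k$ and $c^{(k)}_L>0$ if $\prod_i l_i\ge k$.
   Context: $x^{\underline{n}}=x(x-1)\cdots(x-n+1)$ is the falling factorial power. A $k$-conjoint ranking table of size $l_1\times\cdots\times l_n$ is an $n$-dimensional array of cells indexed by $\{1,\dots,l_1\}\times\cdots\times\{1,\dots,l_n\}$ in which each of the numbers $1,\dots,k$ is placed in exactly one cell, distinct numbers in distinct cells, other cells blank, such that every slice (the set of cells with a fixed value of one coordinate $i$) contains at least one number. -}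

module Defs where

open import Data.Nat using (ℕ; zero; suc; _*_; _∸_; _<_)
open import Data.Nat.Properties using (_≟_)
open import Data.Fin using (Fin)
open import Data.Vec as V using (Vec; []; _∷_; lookup; toList; zipWith)
import Data.Vec.Properties as VP
open import Data.List as L using (List; []; _∷_; concatMap; filter; upTo; length; allFin)
open import Data.List.Relation.Unary.All using (All; all?)
open import Data.List.Relation.Unary.Any using (Any; any?)
open import Data.List.Relation.Unary.Unique.Propositional using (Unique)
import Data.List.Relation.Unary.AllPairs as AllPairs
open import Data.Integer as ℤ using (ℤ; +_)
open import Data.Product using (_×_)
open import Relation.Nullary using (Dec; ¬?)
open import Relation.Nullary.Decidable using (_×-dec_)
open import Relation.Unary using (Decidable)

-- falling factorial power  x^{\underline{k}} = x (x-1) ... (x-k+1)  at a natural point x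
-- (truncated subtraction is harmless: if x < k some factor is 0 anyway)
fall : ℕ → ℕ → ℕ
fall x zero    = 1
fall x (suc k) = fall x k * (x ∸ k)

prodℕ : ∀ {n} → Vec ℕ n → ℕ
prodℕ = V.foldr _ _*_ 1

sumℤ : List ℤ → ℤ
sumℤ = L.foldr ℤ._+_ (+ 0)

vecsBelow : ∀ {n} → Vec ℕ n → List (Vec ℕ n)
vecsBelow []       = [] ∷ []
vecsBelow (b ∷ bs) = concatMap (λ v → L.map (λ vs → v ∷ vs) (vecsBelow bs)) (upTo b)

grid : (n k : ℕ) → List (Vec ℕ n)
grid n k = vecsBelow (V.replicate n (suc k))

monomial : ∀ {n} → Vec ℕ n → Vec ℕ n → ℕ
monomial x L = prodℕ (zipWith fall x L)

-- c is a coefficient family for the falling-factorial expansion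
-- (x_1 ... x_n)^{\underline{k}} = Σ_L c_L x_1^{\underline{l_1}} ... x_n^{\underline{l_n}},
-- an identity of integer polynomials, checked at all points of ℕ^n
-- (which determines a polynomial identity uniquely).
IsExpansion : (n k : ℕ) → (Vec ℕ n → ℤ) → Set
IsExpansion n k c =
  (x : Vec ℕ n) → + fall (prodℕ x) k ≡ sumℤ (L.map (λ L → c L ℤ.* + monomial x L) (grid n k))
  where open import Relation.Binary.PropositionalEquality using (_≡_)

seqs : ∀ {A : Set} (k : ℕ) → List A → List (Vec A k)
seqs zero    xs = [] ∷ []
seqs (suc k) xs = concatMap (λ x → L.map (λ t → x ∷ t) (seqs k xs)) xs

-- A k-conjoint ranking table of size l_1 × ... × l_n, represented by the vector
-- t whose j-th entry is the cell (coordinates, 0-based, in vecsBelow L) holding number j+1.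
-- Distinct numbers in distinct cells, and every slice {cell | cell_i = v} (v < l_i)
-- contains a number.
IsRankingTable : ∀ {n k} → Vec ℕ n → Vec (Vec ℕ n) k → Set
IsRankingTable {n} L t =
  Unique (toList t) ×
  All (λ i → All (λ v → Any (λ cell → lookup cell i ≡ v) (toList t)) (upTo (lookup L i))) (allFin n)
  where open import Relation.Binary.PropositionalEquality using (_≡_)

isRankingTable? : ∀ {n k} (L : Vec ℕ n) → Decidable (IsRankingTable {n} {k} L)
isRankingTable? {n} L t =
  AllPairs.allPairs? (λ x y → ¬? (VP.≡-dec _≟_ x y)) (toList t)
  ×-dec all? (λ i → all? (λ v → any? (λ cell → lookup cell i ≟ v) (toList t)) (upTo (lookup L i))) (allFin n)

numRankingTables : ∀ {n} (k : ℕ) → Vec ℕ n → ℕ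
numRankingTables k L = length (filter (isRankingTable? L) (seqs k (vecsBelow L)))

module Submission where

-- Counting tables by inclusion–exclusion over the slice values they miss shows that the number of
-- k-conjoint ranking tables of size L is the mixed backward difference ∇^L of
-- d ↦ (d₁ ⋯ dₙ)^{\underline k} at d = L.  Applied to an expansion Σ_M c_M x^{\underline M} with
-- all mᵢ ≤ k, ∇^L at L annihilates every falling monomial except x^{\underline L}, which gives
-- l₁! ⋯ lₙ! c_L.  An expansion exists by induction on k, since
-- x · x^{\underline m} = x^{\underline{m+1}} + m x^{\underline m}.  There are at most
-- (∏ lᵢ)^{\underline k} tables, none if ∏ lᵢ < k; and if max lᵢ ≤ k ≤ ∏ lᵢ, the diagonal cells
-- (min(j, lᵢ - 1))ᵢ for j < max lᵢ meet every slice and can be completed by k - max lᵢ further cells.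

open import Defs
open import Data.Nat using (ℕ; zero; suc; _+_; _*_; _∸_; _≤_; _<_; _⊓_; z≤n; s≤s; pred; _!; NonZero)
import Data.Nat.Properties as ℕₚ
open import Data.Nat.ListAction using (sum)
open import Data.Integer as ℤ using (ℤ; +_)
import Data.Integer.Properties as ℤₚ
open import Data.Integer.Tactic.RingSolver using (solve-∀)
open import Data.Nat.Tactic.RingSolver using () renaming (solve-∀ to ℕsolve-∀)
open import Data.Fin using (Fin; zero; suc)
import Data.Fin.Properties as Finₚ
open import Data.Vec as Vec using (Vec; []; _∷_; toList; lookup)
import Data.Vec.Properties as Vecₚ
import Data.Vec.Relation.Unary.All as VecAll
import Data.Vec.Relation.Unary.All.Properties as VecAllₚ
open import Data.Vec.Relation.Binary.Pointwise.Inductive using (Pointwise; []; _∷_)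
open import Data.List using (List; []; _∷_; _++_; map; concatMap; filter; length; upTo; allFin; cartesianProduct)
open import Data.List.Extrema.Nat using (argmax; f[xs]≤f[argmax])
import Data.List.Properties as Listₚ
open import Data.List.Relation.Unary.All as All using (All; []; _∷_)
import Data.List.Relation.Unary.All.Properties as Allₚ
open import Data.List.Relation.Unary.Any as Any using (Any; here; there)
import Data.List.Relation.Unary.Any.Properties as Anyₚ
open import Data.List.Relation.Unary.Unique.Propositional using (Unique)
import Data.List.Relation.Unary.Unique.Propositional.Properties as Uniqueₚ
import Data.List.Relation.Unary.AllPairs as AllPairs
open import Data.List.Membership.Propositional using (_∈_; _∉_; find)
import Data.List.Membership.Propositional.Properties as ∈ₚ
open import Data.Product using (_×_; _,_; proj₁; proj₂; ∃; Σ-syntax)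
import Data.Product.Properties as Productₚ
open import Data.Sum using (inj₁; inj₂)
open import Data.Unit using (tt)
import Data.Unit.Properties as Unitₚ
open import Data.Empty using (⊥-elim)
open import Function using (_∘_; id; _⇔_; mk⇔; Equivalence)
open import Relation.Nullary using (Dec; yes; no; ¬_; ¬?)
open import Relation.Nullary.Decidable using (_×-dec_)
open import Relation.Unary using (Decidable)
open import Relation.Binary.Definitions using (DecidableEquality; tri<; tri≈; tri>)
open import Relation.Binary.PropositionalEquality

private
  variable
    A B X : Set

count : {P : A → Set} → Decidable P → List A → ℕ
count P? []       = 0
count P? (x ∷ xs) with P? x
... | yes _ = suc (count P? xs)
... | no  _ = count P? xs

module _ {P : A → Set} (P? : Decidable P) where

  length-filter≡count : ∀ xs → length (filter P? xs) ≡ count P? xs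
  length-filter≡count []       = refl
  length-filter≡count (x ∷ xs) with P? x
  ... | yes _ = cong suc (length-filter≡count xs)
  ... | no  _ = length-filter≡count xs

  count-++ : ∀ xs ys → count P? (xs ++ ys) ≡ count P? xs + count P? ys
  count-++ []       ys = refl
  count-++ (x ∷ xs) ys with P? x
  ... | yes _ = cong suc (count-++ xs ys)
  ... | no  _ = count-++ xs ys

  count-map : (f : B → A) → ∀ xs → count P? (map f xs) ≡ count (P? ∘ f) xs
  count-map f []       = refl
  count-map f (x ∷ xs) with P? (f x)
  ... | yes _ = cong suc (count-map f xs)
  ... | no  _ = count-map f xs

  count-concatMap : (f : B → List A) → ∀ xs →
                    count P? (concatMap f xs) ≡ sum (map (count P? ∘ f) xs)
  count-concatMap f []       = refl
  count-concatMap f (x ∷ xs) =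
    trans (count-++ (f x) (concatMap f xs)) (cong₂ _+_ refl (count-concatMap f xs))

  count-none : ∀ {xs} → All (¬_ ∘ P) xs → count P? xs ≡ 0
  count-none {[]}     []         = refl
  count-none {x ∷ xs} (¬px ∷ ¬ps) with P? x
  ... | yes px = ⊥-elim (¬px px)
  ... | no  _  = count-none ¬ps

  count-pos : ∀ {x xs} → x ∈ xs → P x → 0 < count P? xs
  count-pos {xs = y ∷ ys} x∈ px with P? y | x∈
  ... | yes _  | _          = s≤s z≤n
  ... | no ¬py | here refl  = ⊥-elim (¬py px)
  ... | no _   | there x∈ys = count-pos x∈ys px

  count-split : {Q : A → Set} (Q? : Decidable Q) → ∀ xs →
    count P? xs ≡ count (λ x → P? x ×-dec Q? x) xs + count (λ x → P? x ×-dec ¬? (Q? x)) xs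
  count-split Q? []       = refl
  count-split Q? (x ∷ xs) with P? x | Q? x
  ... | yes _ | yes _ = cong suc (count-split Q? xs)
  ... | yes _ | no  _ = trans (cong suc (count-split Q? xs)) (sym (ℕₚ.+-suc _ _))
  ... | no  _ | yes _ = count-split Q? xs
  ... | no  _ | no  _ = count-split Q? xs

module _ {P Q : A → Set} (P? : Decidable P) (Q? : Decidable Q) where

  count-mono : (∀ {x} → P x → Q x) → ∀ xs → count P? xs ≤ count Q? xs
  count-mono P⇒Q []       = z≤n
  count-mono P⇒Q (x ∷ xs) with P? x | Q? x
  ... | yes _  | yes _  = s≤s (count-mono P⇒Q xs)
  ... | yes px | no ¬qx = ⊥-elim (¬qx (P⇒Q px))
  ... | no  _  | yes _  = ℕₚ.m≤n⇒m≤1+n (count-mono P⇒Q xs)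
  ... | no  _  | no  _  = count-mono P⇒Q xs

count-cong : {P Q : A → Set} (P? : Decidable P) (Q? : Decidable Q) →
             (∀ {x} → P x → Q x) → (∀ {x} → Q x → P x) → ∀ xs → count P? xs ≡ count Q? xs
count-cong P? Q? P⇒Q Q⇒P xs = ℕₚ.≤-antisym (count-mono P? Q? P⇒Q xs) (count-mono Q? P? Q⇒P xs)

AllV : {k : ℕ} → (A → Set) → Vec A k → Set
AllV Q t = All Q (toList t)

module _ {Q : A → Set} (Q? : Decidable Q) where

  count-seqs-filter : ∀ k xs {P R : Vec A k → Set} (P? : Decidable P) (R? : Decidable R) →
    (∀ {t} → R t ⇔ (P t × AllV Q t)) → count P? (seqs k (filter Q? xs)) ≡ count R? (seqs k xs)
  count-seqs-filter zero xs {P} {R} P? R? R⇔P×Q = count-cong P? R? P⇒R (proj₁ ∘ Equivalence.to R⇔P×Q) (seqs 0 xs)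
    where
    P⇒R : ∀ {t} → P t → R t
    P⇒R {[]} p = Equivalence.from R⇔P×Q (p , [])
  count-seqs-filter (suc k) xs {P} {R} P? R? R⇔P×Q = go xs
    where
    S  = seqs k xs
    S′ = seqs k (filter Q? xs)
    rows : List (Vec A k) → List A → List (Vec A (suc k))
    rows T = concatMap (λ x → map (x ∷_) T)
    go : ∀ ys → count P? (rows S′ (filter Q? ys)) ≡ count R? (rows S ys)
    go []       = refl
    go (y ∷ ys) with Q? y
    ... | yes qy = begin
      count P? (map (y ∷_) S′ ++ rows S′ (filter Q? ys))         ≡⟨ count-++ P? (map (y ∷_) S′) _ ⟩
      count P? (map (y ∷_) S′) + count P? (rows S′ (filter Q? ys)) ≡⟨ cong₂ _+_ headed-by-y (go ys) ⟩
      count R? (map (y ∷_) S) + count R? (rows S ys)              ≡⟨ count-++ R? (map (y ∷_) S) _ ⟨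
      count R? (map (y ∷_) S ++ rows S ys)                        ∎
      where
      open ≡-Reasoning
      tail-equivalence : ∀ {t} → R (y ∷ t) ⇔ (P (y ∷ t) × AllV Q t)
      tail-equivalence = mk⇔ (λ r → let p , qs = Equivalence.to R⇔P×Q r in p , All.tail qs)
                             (λ (p , qs) → Equivalence.from R⇔P×Q (p , qy ∷ qs))
      headed-by-y : count P? (map (y ∷_) S′) ≡ count R? (map (y ∷_) S)
      headed-by-y = begin
        count P? (map (y ∷_) S′)  ≡⟨ count-map P? (y ∷_) S′ ⟩
        count (P? ∘ (y ∷_)) S′    ≡⟨ count-seqs-filter k xs (P? ∘ (y ∷_)) (R? ∘ (y ∷_)) tail-equivalence ⟩
        count (R? ∘ (y ∷_)) S     ≡⟨ count-map R? (y ∷_) S ⟨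
        count R? (map (y ∷_) S)   ∎
    ... | no ¬qy = begin
      count P? (rows S′ (filter Q? ys))               ≡⟨ go ys ⟩
      0 + count R? (rows S ys)                        ≡⟨ cong (_+ count R? (rows S ys)) headed-by-y ⟨
      count R? (map (y ∷_) S) + count R? (rows S ys)  ≡⟨ count-++ R? (map (y ∷_) S) _ ⟨
      count R? (map (y ∷_) S ++ rows S ys)            ∎
      where
      open ≡-Reasoning
      headed-by-y : count R? (map (y ∷_) S) ≡ 0
      headed-by-y = trans (count-map R? (y ∷_) S)
        (count-none (R? ∘ (y ∷_)) (All.universal (λ t r → ¬qy (All.head (proj₂ (Equivalence.to R⇔P×Q r)))) S))

seqs-map : (f : A → B) → ∀ k xs → seqs k (map f xs) ≡ map (Vec.map f) (seqs k xs)
seqs-map f zero    xs = refl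
seqs-map f (suc k) xs = begin
  concatMap (λ x → map (x ∷_) (seqs k (map f xs))) (map f xs)    ≡⟨ Listₚ.concatMap-map _ f xs ⟩
  concatMap (λ y → map (f y ∷_) (seqs k (map f xs))) xs          ≡⟨ Listₚ.concatMap-cong pointwise xs ⟩
  concatMap (λ y → map (Vec.map f) (map (y ∷_) (seqs k xs))) xs  ≡⟨ Listₚ.map-concatMap (Vec.map f) _ xs ⟨
  map (Vec.map f) (concatMap (λ y → map (y ∷_) (seqs k xs)) xs)  ∎
  where
  open ≡-Reasoning
  pointwise : ∀ y → map (f y ∷_) (seqs k (map f xs)) ≡ map (Vec.map f) (map (y ∷_) (seqs k xs))
  pointwise y = trans (cong (map (f y ∷_)) (seqs-map f k xs))
                      (trans (sym (Listₚ.map-∘ (seqs k xs))) (Listₚ.map-∘ (seqs k xs)))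

∈-seqs : ∀ k {xs : List A} (t : Vec A k) → AllV (_∈ xs) t → t ∈ seqs k xs
∈-seqs zero             []      _         = here refl
∈-seqs (suc k) {xs} (x ∷ t) (x∈ ∷ t⊆) =
  ∈ₚ.∈-concat⁺′ (∈ₚ.∈-map⁺ (x ∷_) (∈-seqs k t t⊆)) (∈ₚ.∈-map⁺ (λ x → map (x ∷_) (seqs k xs)) x∈)

-- Falling factorials

fall-suc : ∀ m k → fall m (suc k) ≡ m * fall (pred m) k
fall-suc m       zero    = trans (ℕₚ.*-identityˡ m) (sym (ℕₚ.*-identityʳ m))
fall-suc zero    (suc k) = ℕₚ.*-zeroʳ (fall 0 (suc k))
fall-suc (suc m) (suc k) = begin
  fall (suc m) (suc k) * (m ∸ k)  ≡⟨ cong (_* (m ∸ k)) (fall-suc (suc m) k) ⟩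
  suc m * fall m k * (m ∸ k)      ≡⟨ ℕₚ.*-assoc (suc m) (fall m k) (m ∸ k) ⟩
  suc m * fall m (suc k)          ∎
  where open ≡-Reasoning

fall-< : ∀ {y q} → y < q → fall y q ≡ 0
fall-< {y} {suc q} (s≤s y≤q) with ℕₚ.m≤n⇒m<n∨m≡n y≤q
... | inj₁ y<q  = cong (_* (y ∸ q)) (fall-< y<q)
... | inj₂ refl = trans (cong (fall y y *_) (ℕₚ.n∸n≡0 y)) (ℕₚ.*-zeroʳ (fall y y))

fall-self : ∀ l → fall l l ≡ l !
fall-self zero    = refl
fall-self (suc l) = trans (fall-suc (suc l) l) (cong (suc l *_) (fall-self l))

fall-pascal : ∀ y q → fall (suc y) q ≡ fall y q + q * fall y (pred q)
fall-pascal y zero    = refl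
fall-pascal y (suc q) with ℕₚ.≤-<-connex q y
... | inj₁ q≤y = begin
  fall (suc y) (suc q)                   ≡⟨ fall-suc (suc y) q ⟩
  suc y * fall y q                       ≡⟨ cong (_* fall y q) (ℕₚ.m∸n+n≡m (s≤s q≤y)) ⟨
  ((y ∸ q) + suc q) * fall y q           ≡⟨ ℕₚ.*-distribʳ-+ (fall y q) (y ∸ q) (suc q) ⟩
  (y ∸ q) * fall y q + suc q * fall y q  ≡⟨ cong (_+ suc q * fall y q) (ℕₚ.*-comm (y ∸ q) (fall y q)) ⟩
  fall y q * (y ∸ q) + suc q * fall y q  ∎
  where open ≡-Reasoning
... | inj₂ y<q = begin
  fall (suc y) (suc q)                   ≡⟨ fall-< (s≤s y<q) ⟩
  0                                      ≡⟨ ℕₚ.*-zeroʳ (suc q) ⟨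
  suc q * 0                              ≡⟨ cong₂ (λ a b → a * (y ∸ q) + suc q * b) (fall-< y<q) (fall-< y<q) ⟨
  fall y q * (y ∸ q) + suc q * fall y q  ∎
  where open ≡-Reasoning

suc-pred-length : ∀ {x : A} {xs} → x ∈ xs → suc (pred (length xs)) ≡ length xs
suc-pred-length (here _)  = refl
suc-pred-length (there _) = refl

sum-map-const : (f : A → ℕ) {c : ℕ} → ∀ {xs} → All (λ x → f x ≡ c) xs → sum (map f xs) ≡ length xs * c
sum-map-const f []       = refl
sum-map-const f (e ∷ es) = cong₂ _+_ e (sum-map-const f es)

module _ (_≟_ : DecidableEquality A) where

  _≢?_ : (x y : A) → Dec (x ≢ y)
  x ≢? y = ¬? (x ≟ y)

  injective? : ∀ {k} → Decidable (λ (t : Vec A k) → Unique (toList t))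
  injective? t = AllPairs.allPairs? _≢?_ (toList t)

  length-filter-≢ : ∀ {x xs} → Unique xs → x ∈ xs → length (filter (x ≢?_) xs) ≡ pred (length xs)
  length-filter-≢ {x} (x∉ys AllPairs.∷ _) (here refl) with x ≟ x
  ... | yes _   = cong length (Listₚ.filter-all (x ≢?_) x∉ys)
  ... | no x≢x  = ⊥-elim (x≢x refl)
  length-filter-≢ {x} {y ∷ ys} (y∉ys AllPairs.∷ u) (there x∈ys) with x ≟ y
  ... | yes refl = ⊥-elim (All.lookup y∉ys x∈ys refl)
  ... | no _     = trans (cong suc (length-filter-≢ u x∈ys)) (suc-pred-length x∈ys)

  count-injective-seqs : ∀ k {xs} → Unique xs → count injective? (seqs k xs) ≡ fall (length xs) k
  count-injective-seqs zero    u = refl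
  count-injective-seqs (suc k) {xs} u = begin
    count injective? (concatMap (λ x → map (x ∷_) (seqs k xs)) xs)  ≡⟨ count-concatMap injective? _ xs ⟩
    sum (map (λ x → count injective? (map (x ∷_) (seqs k xs))) xs)  ≡⟨ sum-map-const _ (All.tabulate starting-with) ⟩
    length xs * fall (pred (length xs)) k                             ≡⟨ fall-suc (length xs) k ⟨
    fall (length xs) (suc k)                                          ∎
    where
    open ≡-Reasoning
    starting-with : ∀ {x} → x ∈ xs → count injective? (map (x ∷_) (seqs k xs)) ≡ fall (pred (length xs)) k
    starting-with {x} x∈xs = begin
      count injective? (map (x ∷_) (seqs k xs))      ≡⟨ count-map injective? (x ∷_) (seqs k xs) ⟩
      count (injective? ∘ (x ∷_)) (seqs k xs)        ≡⟨ count-seqs-filter (x ≢?_) k xs injective? (injective? ∘ (x ∷_))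
                                                          (mk⇔ (λ u → AllPairs.tail u , AllPairs.head u) (λ (u , x∉) → x∉ AllPairs.∷ u)) ⟨
      count injective? (seqs k (filter (x ≢?_) xs))  ≡⟨ count-injective-seqs k (Uniqueₚ.filter⁺ (x ≢?_) u) ⟩
      fall (length (filter (x ≢?_) xs)) k            ≡⟨ cong (λ m → fall m k) (length-filter-≢ u x∈xs) ⟩
      fall (pred (length xs)) k                      ∎

-- Backward differences

-- r-th backward difference of f at d; the junk step below 0 (pred 0 = 0) is never taken, since
-- r ≤ d wherever ∇ is used.
∇ : (ℕ → ℤ) → ℕ → ℕ → ℤ
∇ f zero    d = f d
∇ f (suc r) d = ∇ f r d ℤ.- ∇ f r (pred d)

∇ᵛ : ∀ {n} → (Vec ℕ n → ℤ) → Vec ℕ n → Vec ℕ n → ℤ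
∇ᵛ p []       []       = p []
∇ᵛ p (r ∷ rs) (d ∷ ds) = ∇ (λ x → ∇ᵛ (λ ys → p (x ∷ ys)) rs ds) r d

∇-cong : ∀ {f g} → (∀ x → f x ≡ g x) → ∀ r d → ∇ f r d ≡ ∇ g r d
∇-cong f≗g zero    d = f≗g d
∇-cong f≗g (suc r) d = cong₂ ℤ._-_ (∇-cong f≗g r d) (∇-cong f≗g r (pred d))

∇-+ : ∀ f g r d → ∇ (λ x → f x ℤ.+ g x) r d ≡ ∇ f r d ℤ.+ ∇ g r d
∇-+ f g zero    d = refl
∇-+ f g (suc r) d =
  trans (cong₂ ℤ._-_ (∇-+ f g r d) (∇-+ f g r (pred d))) (rearrange (∇ f r d) (∇ g r d) _ _)
  where
  rearrange : ∀ a b c e → (a ℤ.+ b) ℤ.- (c ℤ.+ e) ≡ (a ℤ.- c) ℤ.+ (b ℤ.- e)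
  rearrange = solve-∀

∇-*ˡ : ∀ a f r d → ∇ (λ x → a ℤ.* f x) r d ≡ a ℤ.* ∇ f r d
∇-*ˡ a f zero    d = refl
∇-*ˡ a f (suc r) d =
  trans (cong₂ ℤ._-_ (∇-*ˡ a f r d) (∇-*ˡ a f r (pred d))) (factor a _ _)
  where
  factor : ∀ a b c → a ℤ.* b ℤ.- a ℤ.* c ≡ a ℤ.* (b ℤ.- c)
  factor = solve-∀

∇-*ʳ : ∀ a f r d → ∇ (λ x → f x ℤ.* a) r d ≡ ∇ f r d ℤ.* a
∇-*ʳ a f r d = trans (∇-cong (λ x → ℤₚ.*-comm (f x) a) r d) (trans (∇-*ˡ a f r d) (ℤₚ.*-comm a _))

∇-0 : ∀ r d → ∇ (λ _ → + 0) r d ≡ + 0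
∇-0 zero    d = refl
∇-0 (suc r) d = cong₂ ℤ._-_ (∇-0 r d) (∇-0 r (pred d))

∇ᵛ-cong : ∀ {n} {p q : Vec ℕ n → ℤ} → (∀ x → p x ≡ q x) → ∀ rs ds → ∇ᵛ p rs ds ≡ ∇ᵛ q rs ds
∇ᵛ-cong p≗q []       []       = p≗q []
∇ᵛ-cong p≗q (r ∷ rs) (d ∷ ds) = ∇-cong (λ x → ∇ᵛ-cong (λ ys → p≗q (x ∷ ys)) rs ds) r d

∇ᵛ-+ : ∀ {n} (p q : Vec ℕ n → ℤ) rs ds → ∇ᵛ (λ x → p x ℤ.+ q x) rs ds ≡ ∇ᵛ p rs ds ℤ.+ ∇ᵛ q rs ds
∇ᵛ-+ p q []       []       = refl
∇ᵛ-+ p q (r ∷ rs) (d ∷ ds) =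
  trans (∇-cong (λ y → ∇ᵛ-+ (λ ys → p (y ∷ ys)) (λ ys → q (y ∷ ys)) rs ds) r d) (∇-+ _ _ r d)

∇ᵛ-*ˡ : ∀ {n} a (p : Vec ℕ n → ℤ) rs ds → ∇ᵛ (λ x → a ℤ.* p x) rs ds ≡ a ℤ.* ∇ᵛ p rs ds
∇ᵛ-*ˡ a p []       []       = refl
∇ᵛ-*ˡ a p (r ∷ rs) (d ∷ ds) = trans (∇-cong (λ y → ∇ᵛ-*ˡ a (λ ys → p (y ∷ ys)) rs ds) r d) (∇-*ˡ a _ r d)

∇ᵛ-0 : ∀ {n} (rs ds : Vec ℕ n) → ∇ᵛ (λ _ → + 0) rs ds ≡ + 0
∇ᵛ-0 []       []       = refl
∇ᵛ-0 (r ∷ rs) (d ∷ ds) = trans (∇-cong (λ _ → ∇ᵛ-0 rs ds) r d) (∇-0 r d)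

∇ᵛ-sum : ∀ {n} (F : A → Vec ℕ n → ℤ) js rs ds →
         ∇ᵛ (λ x → sumℤ (map (λ j → F j x) js)) rs ds ≡ sumℤ (map (λ j → ∇ᵛ (F j) rs ds) js)
∇ᵛ-sum F []       rs ds = ∇ᵛ-0 rs ds
∇ᵛ-sum F (j ∷ js) rs ds =
  trans (∇ᵛ-+ (F j) (λ x → sumℤ (map (λ j → F j x) js)) rs ds)
        (cong₂ ℤ._+_ (refl {x = ∇ᵛ (F j) rs ds}) (∇ᵛ-sum F js rs ds))


∇-fall : ∀ m {r d} → r ≤ d → ∇ (λ y → + fall y m) r d ≡ + (fall m r * fall (d ∸ r) (m ∸ r))
∇-fall m {zero}              _         = cong +_ (sym (ℕₚ.*-identityˡ _))
∇-fall m {suc r} {suc d} (s≤s r≤d) = begin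
  ∇ (λ y → + fall y m) r (suc d) ℤ.- ∇ (λ y → + fall y m) r d
    ≡⟨ cong₂ ℤ._-_ (∇-fall m (ℕₚ.m≤n⇒m≤1+n r≤d)) (∇-fall m r≤d) ⟩
  + (F * fall (suc d ∸ r) q) ℤ.- + (F * fall y q)
    ≡⟨ cong (λ z → + (F * fall z q) ℤ.- + (F * fall y q)) (ℕₚ.+-∸-assoc 1 r≤d) ⟩
  + (F * fall (suc y) q) ℤ.- + (F * fall y q)
    ≡⟨ cong (λ z → + (F * z) ℤ.- + (F * fall y q)) (fall-pascal y q) ⟩
  + (F * (fall y q + q * fall y (pred q))) ℤ.- + (F * fall y q)
    ≡⟨ cong (ℤ._- + (F * fall y q)) (trans (cong +_ (ℕₚ.*-distribˡ-+ F (fall y q) _)) (ℤₚ.pos-+ (F * fall y q) _)) ⟩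
  + (F * fall y q) ℤ.+ + (F * (q * fall y (pred q))) ℤ.- + (F * fall y q)
    ≡⟨ cancel (+ (F * fall y q)) (+ (F * (q * fall y (pred q)))) ⟩
  + (F * (q * fall y (pred q)))
    ≡⟨ cong +_ (sym (ℕₚ.*-assoc F q _)) ⟩
  + (fall m (suc r) * fall y (pred q))
    ≡⟨ cong (λ z → + (fall m (suc r) * fall y z)) (ℕₚ.pred[m∸n]≡m∸[1+n] m r) ⟩
  + (fall m (suc r) * fall (suc d ∸ suc r) (m ∸ suc r)) ∎
  where
  open ≡-Reasoning
  F = fall m r
  q = m ∸ r
  y = d ∸ r
  cancel : ∀ a b → a ℤ.+ b ℤ.- a ≡ b
  cancel = solve-∀

∇-fall-diagonal : ∀ m l → ∇ (λ y → + fall y m) l l ≡ + (fall m l * fall 0 (m ∸ l))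
∇-fall-diagonal m l =
  trans (∇-fall m {l} ℕₚ.≤-refl) (cong (λ z → + (fall m l * fall z (m ∸ l))) (ℕₚ.n∸n≡0 l))

∇-fall-self : ∀ l → ∇ (λ y → + fall y l) l l ≡ + (l !)
∇-fall-self l = begin
  ∇ (λ y → + fall y l) l l       ≡⟨ ∇-fall-diagonal l l ⟩
  + (fall l l * fall 0 (l ∸ l))  ≡⟨ cong (λ z → + (fall l l * fall 0 z)) (ℕₚ.n∸n≡0 l) ⟩
  + (fall l l * 1)               ≡⟨ cong +_ (trans (ℕₚ.*-identityʳ _) (fall-self l)) ⟩
  + (l !)                        ∎
  where open ≡-Reasoning

∇-fall-other : ∀ {m l} → m ≢ l → ∇ (λ y → + fall y m) l l ≡ + 0
∇-fall-other {m} {l} m≢l with ℕₚ.<-cmp m l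
... | tri< m<l _ _ = trans (∇-fall-diagonal m l) (cong (λ z → + (z * fall 0 (m ∸ l))) (fall-< m<l))
... | tri≈ _ m≡l _ = ⊥-elim (m≢l m≡l)
... | tri> _ _ m>l = trans (∇-fall-diagonal m l)
  (cong +_ (trans (cong (fall m l *_) (fall-< (ℕₚ.m<n⇒0<n∸m m>l))) (ℕₚ.*-zeroʳ (fall m l))))

∇ᵛ-monomial-∷ : ∀ {n} m (M rs ds : Vec ℕ n) r d →
  ∇ᵛ (λ x → + monomial x (m ∷ M)) (r ∷ rs) (d ∷ ds)
    ≡ ∇ (λ y → + fall y m) r d ℤ.* ∇ᵛ (λ x → + monomial x M) rs ds
∇ᵛ-monomial-∷ m M rs ds r d = begin
  ∇ (λ y → ∇ᵛ (λ ys → + (fall y m * monomial ys M)) rs ds) r d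
    ≡⟨ ∇-cong (λ y → trans (∇ᵛ-cong (λ ys → ℤₚ.pos-* (fall y m) _) rs ds) (∇ᵛ-*ˡ (+ fall y m) _ rs ds)) r d ⟩
  ∇ (λ y → + fall y m ℤ.* ∇ᵛ (λ ys → + monomial ys M) rs ds) r d
    ≡⟨ ∇-*ʳ _ (λ y → + fall y m) r d ⟩
  ∇ (λ y → + fall y m) r d ℤ.* ∇ᵛ (λ x → + monomial x M) rs ds ∎
  where open ≡-Reasoning

∇ᵛ-monomial-self : ∀ {n} (L : Vec ℕ n) → ∇ᵛ (λ x → + monomial x L) L L ≡ + prodℕ (Vec.map _! L)
∇ᵛ-monomial-self []      = refl
∇ᵛ-monomial-self (l ∷ L) = begin
  ∇ᵛ (λ x → + monomial x (l ∷ L)) (l ∷ L) (l ∷ L)  ≡⟨ ∇ᵛ-monomial-∷ l L L L l l ⟩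
  ∇ (λ y → + fall y l) l l ℤ.* ∇ᵛ (λ x → + monomial x L) L L
                                                   ≡⟨ cong₂ ℤ._*_ (∇-fall-self l) (∇ᵛ-monomial-self L) ⟩
  + (l !) ℤ.* + prodℕ (Vec.map _! L)               ≡⟨ ℤₚ.pos-* (l !) _ ⟨
  + prodℕ (Vec.map _! (l ∷ L))                     ∎
  where open ≡-Reasoning

∇ᵛ-monomial-other : ∀ {n} {M L : Vec ℕ n} → M ≢ L → ∇ᵛ (λ x → + monomial x M) L L ≡ + 0
∇ᵛ-monomial-other {M = []}    {[]}    M≢L = ⊥-elim (M≢L refl)
∇ᵛ-monomial-other {M = m ∷ M} {l ∷ L} M≢L with m ℕₚ.≟ l
... | no m≢l   = trans (∇ᵛ-monomial-∷ m M L L l l)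
                       (cong (ℤ._* ∇ᵛ (λ x → + monomial x M) L L) (∇-fall-other m≢l))
... | yes refl = trans (∇ᵛ-monomial-∷ m M L L l l)
                       (trans (cong (∇ (λ y → + fall y m) l l ℤ.*_) (∇ᵛ-monomial-other (M≢L ∘ cong (m ∷_))))
                              (ℤₚ.*-zeroʳ (∇ (λ y → + fall y m) l l)))

length-cartesianProduct : ∀ (xs : List A) (ys : List B) →
                          length (cartesianProduct xs ys) ≡ length xs * length ys
length-cartesianProduct []       ys = refl
length-cartesianProduct (x ∷ xs) ys =
  trans (Listₚ.length-++ (map (x ,_) ys))
        (cong₂ _+_ (Listₚ.length-map (x ,_) ys) (length-cartesianProduct xs ys))

filter-map : {P : B → Set} (P? : Decidable P) (f : A → B) → ∀ xs →
             filter P? (map f xs) ≡ map f (filter (P? ∘ f) xs)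
filter-map P? f []       = refl
filter-map P? f (x ∷ xs) with P? (f x)
... | yes _ = cong (f x ∷_) (filter-map P? f xs)
... | no  _ = filter-map P? f xs

filter-cartesianProduct₁ : {Q : A → Set} (Q? : Decidable Q) → ∀ xs (ys : List B) →
  filter (Q? ∘ proj₁) (cartesianProduct xs ys) ≡ cartesianProduct (filter Q? xs) ys
filter-cartesianProduct₁ Q? []       ys = refl
filter-cartesianProduct₁ Q? (x ∷ xs) ys with Q? x
... | yes qx = trans (Listₚ.filter-++ (Q? ∘ proj₁) (map (x ,_) ys) _)
  (cong₂ _++_ (Listₚ.filter-all (Q? ∘ proj₁) (Allₚ.map⁺ (All.universal (λ _ → qx) ys)))
              (filter-cartesianProduct₁ Q? xs ys))
... | no ¬qx = trans (Listₚ.filter-++ (Q? ∘ proj₁) (map (x ,_) ys) _)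
  (cong₂ _++_ (Listₚ.filter-none (Q? ∘ proj₁) (Allₚ.map⁺ (All.universal (λ _ → ¬qx) ys)))
              (filter-cartesianProduct₁ Q? xs ys))

filter-cartesianProduct₂ : {Q : B → Set} (Q? : Decidable Q) → ∀ (xs : List A) ys →
  filter (Q? ∘ proj₂) (cartesianProduct xs ys) ≡ cartesianProduct xs (filter Q? ys)
filter-cartesianProduct₂ Q? []       ys = refl
filter-cartesianProduct₂ Q? (x ∷ xs) ys = trans (Listₚ.filter-++ (Q? ∘ proj₂) (map (x ,_) ys) _)
  (cong₂ _++_ (filter-map (Q? ∘ proj₂) (x ,_) ys) (filter-cartesianProduct₂ Q? xs ys))

reassoc : ∀ {n} → (X × ℕ) × Vec ℕ n → X × Vec ℕ (suc n)
reassoc ((a , v) , vs) = a , v ∷ vs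

reassoc-injective : ∀ {n} {p q : (X × ℕ) × Vec ℕ n} → reassoc p ≡ reassoc q → p ≡ q
reassoc-injective {p = (a , v) , vs} {(b , w) , ws} refl = refl

-- cells A (D₁ ∷ ⋯ ∷ Dₙ) enumerates A × D₁ × ⋯ × Dₙ; the tag set A absorbs one coordinate
-- after another, which is what lets the inclusion–exclusion below run by induction on n.
cells : ∀ {n} → List X → Vec (List ℕ) n → List (X × Vec ℕ n)
cells A []       = map (_, []) A
cells A (D ∷ Ds) = map reassoc (cells (cartesianProduct A D) Ds)

cells-unique : ∀ {n} {A : List X} {Ds : Vec (List ℕ) n} →
               Unique A → VecAll.All Unique Ds → Unique (cells A Ds)
cells-unique uA VecAll.[]         = Uniqueₚ.map⁺ (cong proj₁) uA
cells-unique uA (uD VecAll.∷ uDs) =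
  Uniqueₚ.map⁺ reassoc-injective (cells-unique (Uniqueₚ.cartesianProduct⁺ uA uD) uDs)

length-cells : ∀ {n} (A : List X) (Ds : Vec (List ℕ) n) →
               length (cells A Ds) ≡ length A * prodℕ (Vec.map length Ds)
length-cells A []       = trans (Listₚ.length-map _ A) (sym (ℕₚ.*-identityʳ _))
length-cells A (D ∷ Ds) = begin
  length (map reassoc (cells (cartesianProduct A D) Ds))  ≡⟨ Listₚ.length-map reassoc (cells (cartesianProduct A D) Ds) ⟩
  length (cells (cartesianProduct A D) Ds)                ≡⟨ length-cells _ Ds ⟩
  length (cartesianProduct A D) * P                       ≡⟨ cong (_* P) (length-cartesianProduct A D) ⟩
  length A * length D * P                                 ≡⟨ ℕₚ.*-assoc (length A) _ _ ⟩
  length A * (length D * P)                               ∎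
  where
  open ≡-Reasoning
  P = prodℕ (Vec.map length Ds)

filter-cells-tag : ∀ {n} {Q : X → Set} (Q? : Decidable Q) A (Ds : Vec (List ℕ) n) →
                   filter (Q? ∘ proj₁) (cells A Ds) ≡ cells (filter Q? A) Ds
filter-cells-tag Q? A []       = filter-map (Q? ∘ proj₁) (_, []) A
filter-cells-tag Q? A (D ∷ Ds) = begin
  filter (Q? ∘ proj₁) (map reassoc (cells (cartesianProduct A D) Ds))
    ≡⟨ filter-map (Q? ∘ proj₁) reassoc (cells (cartesianProduct A D) Ds) ⟩
  map reassoc (filter (Q? ∘ proj₁ ∘ proj₁) (cells (cartesianProduct A D) Ds))
    ≡⟨ cong (map reassoc) (filter-cells-tag (Q? ∘ proj₁) (cartesianProduct A D) Ds) ⟩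
  map reassoc (cells (filter (Q? ∘ proj₁) (cartesianProduct A D)) Ds)
    ≡⟨ cong (λ B → map reassoc (cells B Ds)) (filter-cartesianProduct₁ Q? A D) ⟩
  map reassoc (cells (cartesianProduct (filter Q? A) D) Ds) ∎
  where open ≡-Reasoning

filter-cells-first : ∀ {n} {Q : ℕ → Set} (Q? : Decidable Q) (A : List X) D (Ds : Vec (List ℕ) n) →
  filter (λ c → Q? (lookup (proj₂ c) zero)) (cells A (D ∷ Ds)) ≡ cells A (filter Q? D ∷ Ds)
filter-cells-first Q? A D Ds = begin
  filter (λ c → Q? (lookup (proj₂ c) zero)) (map reassoc (cells (cartesianProduct A D) Ds))
    ≡⟨ filter-map (λ c → Q? (lookup (proj₂ c) zero)) reassoc (cells (cartesianProduct A D) Ds) ⟩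
  map reassoc (filter (Q? ∘ proj₂ ∘ proj₁) (cells (cartesianProduct A D) Ds))
    ≡⟨ cong (map reassoc) (filter-cells-tag (Q? ∘ proj₂) (cartesianProduct A D) Ds) ⟩
  map reassoc (cells (filter (Q? ∘ proj₂) (cartesianProduct A D)) Ds)
    ≡⟨ cong (λ B → map reassoc (cells B Ds)) (filter-cartesianProduct₂ Q? A D) ⟩
  map reassoc (cells (cartesianProduct A (filter Q? D)) Ds) ∎
  where open ≡-Reasoning

map-reassoc-cartesianProduct : ∀ {n} (A : List X) (D : List ℕ) (P : List (Vec ℕ n)) →
  map reassoc (cartesianProduct (cartesianProduct A D) P)
    ≡ cartesianProduct A (concatMap (λ v → map (v ∷_) P) D)
map-reassoc-cartesianProduct []      D P = refl
map-reassoc-cartesianProduct (a ∷ A) D P = begin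
  map reassoc (cartesianProduct (map (a ,_) D ++ cartesianProduct A D) P)
    ≡⟨ cong (map reassoc) (Listₚ.cartesianProductWith-distribʳ-++ _,_ (map (a ,_) D) _ P) ⟩
  map reassoc (cartesianProduct (map (a ,_) D) P ++ cartesianProduct (cartesianProduct A D) P)
    ≡⟨ Listₚ.map-++ reassoc (cartesianProduct (map (a ,_) D) P) _ ⟩
  map reassoc (cartesianProduct (map (a ,_) D) P) ++ map reassoc (cartesianProduct (cartesianProduct A D) P)
    ≡⟨ cong₂ _++_ (tagged D) (map-reassoc-cartesianProduct A D P) ⟩
  map (a ,_) (concatMap (λ v → map (v ∷_) P) D) ++ cartesianProduct A (concatMap (λ v → map (v ∷_) P) D) ∎
  where
  open ≡-Reasoning
  tagged : ∀ D → map reassoc (cartesianProduct (map (a ,_) D) P) ≡ map (a ,_) (concatMap (λ v → map (v ∷_) P) D)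
  tagged []      = refl
  tagged (v ∷ D) = begin
    map reassoc (map ((a , v) ,_) P ++ cartesianProduct (map (a ,_) D) P)
      ≡⟨ Listₚ.map-++ reassoc (map ((a , v) ,_) P) _ ⟩
    map reassoc (map ((a , v) ,_) P) ++ map reassoc (cartesianProduct (map (a ,_) D) P)
      ≡⟨ cong₂ _++_ (trans (sym (Listₚ.map-∘ P)) (Listₚ.map-∘ P)) (tagged D) ⟩
    map (a ,_) (map (v ∷_) P) ++ map (a ,_) (concatMap (λ v → map (v ∷_) P) D)
      ≡⟨ Listₚ.map-++ (a ,_) (map (v ∷_) P) _ ⟨
    map (a ,_) (map (v ∷_) P ++ concatMap (λ v → map (v ∷_) P) D) ∎

cells-vecsBelow : ∀ {n} (A : List X) (L : Vec ℕ n) →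
                  cells A (Vec.map upTo L) ≡ cartesianProduct A (vecsBelow L)
cells-vecsBelow A []      = untagged A
  where
  untagged : ∀ A → map (_, []) A ≡ cartesianProduct A ([] ∷ [])
  untagged []      = refl
  untagged (a ∷ A) = cong ((a , []) ∷_) (untagged A)
cells-vecsBelow A (b ∷ L) =
  trans (cong (map reassoc) (cells-vecsBelow (cartesianProduct A (upTo b)) L))
        (map-reassoc-cartesianProduct A (upTo b) (vecsBelow L))

Covers : ∀ {n} → Vec (List ℕ) n → List (Vec ℕ n) → Set
Covers {n} Rs cs = ∀ (i : Fin n) → All (λ v → Any (λ c → lookup c i ≡ v) cs) (lookup Rs i)

covers? : ∀ {n} (Rs : Vec (List ℕ) n) → Decidable (Covers Rs)
covers? Rs cs = Finₚ.all? (λ i → All.all? (λ v → Any.any? (λ c → lookup c i ℕₚ.≟ v) cs) (lookup Rs i))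

Covers-[]∷⇔ : ∀ {n} {Rs : Vec (List ℕ) n} {cs} → Covers ([] ∷ Rs) cs ⇔ Covers Rs (map Vec.tail cs)
Covers-[]∷⇔ = mk⇔
  (λ cov i → All.map (λ hit → Anyₚ.map⁺ (Any.map (λ { {_ ∷ _} e → e }) hit)) (cov (suc i)))
  (λ { cov zero → [] ; cov (suc i) → All.map (λ hit → Any.map (λ { {_ ∷ _} e → e }) (Anyₚ.map⁻ hit)) (cov i) })

Covers-∷⇔ : ∀ {n} {v R} {Rs : Vec (List ℕ) n} {cs} →
            Covers ((v ∷ R) ∷ Rs) cs ⇔ (Covers (R ∷ Rs) cs × Any (λ c → lookup c zero ≡ v) cs)
Covers-∷⇔ = mk⇔
  (λ cov → (λ { zero → All.tail (cov zero) ; (suc i) → cov (suc i) }) , All.head (cov zero))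
  (λ { (cov , hit) zero → hit ∷ cov zero ; (cov , hit) (suc i) → cov (suc i) })

_≟ᵛ_ : ∀ {n} → DecidableEquality (Vec ℕ n)
_≟ᵛ_ = Vecₚ.≡-dec ℕₚ._≟_

≡-dec-cell : ∀ {n} → DecidableEquality X → DecidableEquality (X × Vec ℕ n)
≡-dec-cell _≟_ = Productₚ.≡-dec _≟_ _≟ᵛ_

IsTable : ∀ {n k} → Vec (List ℕ) n → Vec (X × Vec ℕ n) k → Set
IsTable Rs t = Unique (toList t) × Covers Rs (map proj₂ (toList t))

isTable? : ∀ {n k} → DecidableEquality X → (Rs : Vec (List ℕ) n) → Decidable (IsTable {X} {n} {k} Rs)
isTable? _≟_ Rs t = injective? (≡-dec-cell _≟_) t ×-dec covers? Rs (map proj₂ (toList t))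

tail-reassoc : ∀ {n k} (t : Vec ((X × ℕ) × Vec ℕ n) k) →
               map Vec.tail (map proj₂ (toList (Vec.map reassoc t))) ≡ map proj₂ (toList t)
tail-reassoc []      = refl
tail-reassoc (c ∷ t) = cong (proj₂ c ∷_) (tail-reassoc t)

count-tables-reassoc : ∀ {n} k (_≟_ : DecidableEquality X) A D (Rs Ds : Vec (List ℕ) n) →
  count (isTable? _≟_ ([] ∷ Rs)) (seqs k (cells A (D ∷ Ds)))
    ≡ count (isTable? (Productₚ.≡-dec _≟_ ℕₚ._≟_) Rs) (seqs k (cells (cartesianProduct A D) Ds))
count-tables-reassoc k _≟_ A D Rs Ds = begin
  count (isTable? _≟_ ([] ∷ Rs)) (seqs k (map reassoc C))
    ≡⟨ cong (count (isTable? _≟_ ([] ∷ Rs))) (seqs-map reassoc k C) ⟩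
  count (isTable? _≟_ ([] ∷ Rs)) (map (Vec.map reassoc) (seqs k C))
    ≡⟨ count-map (isTable? _≟_ ([] ∷ Rs)) (Vec.map reassoc) (seqs k C) ⟩
  count (isTable? _≟_ ([] ∷ Rs) ∘ Vec.map reassoc) (seqs k C)
    ≡⟨ count-cong _ (isTable? (Productₚ.≡-dec _≟_ ℕₚ._≟_) Rs) forget remember (seqs k C) ⟩
  count (isTable? (Productₚ.≡-dec _≟_ ℕₚ._≟_) Rs) (seqs k C) ∎
  where
  open ≡-Reasoning
  C = cells (cartesianProduct A D) Ds
  forget : ∀ {t} → IsTable ([] ∷ Rs) (Vec.map reassoc t) → IsTable Rs t
  forget {t} (u , cov) =
    Uniqueₚ.map⁻ (subst Unique (Vecₚ.toList-map reassoc t) u) ,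
    subst (Covers Rs) (tail-reassoc t) (Equivalence.to Covers-[]∷⇔ cov)
  remember : ∀ {t} → IsTable Rs t → IsTable ([] ∷ Rs) (Vec.map reassoc t)
  remember {t} (u , cov) =
    subst Unique (sym (Vecₚ.toList-map reassoc t)) (Uniqueₚ.map⁺ reassoc-injective u) ,
    Equivalence.from Covers-[]∷⇔ (subst (Covers Rs) (sym (tail-reassoc t)) cov)

count-tables-split : ∀ {n} k (_≟_ : DecidableEquality X) A v R D (Rs Ds : Vec (List ℕ) n) →
  count (isTable? _≟_ ((v ∷ R) ∷ Rs)) (seqs k (cells A (D ∷ Ds)))
    + count (isTable? _≟_ (R ∷ Rs)) (seqs k (cells A (filter (¬? ∘ (v ℕₚ.≟_)) D ∷ Ds)))
  ≡ count (isTable? _≟_ (R ∷ Rs)) (seqs k (cells A (D ∷ Ds)))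
count-tables-split {n = n} k _≟_ A v R D Rs Ds = begin
  count (isTable? _≟_ ((v ∷ R) ∷ Rs)) S + count T? (seqs k (cells A (filter avoids? D ∷ Ds)))
    ≡⟨ cong₂ _+_ covering-v (cong (count T? ∘ seqs k) (sym (filter-cells-first avoids? A D Ds))) ⟩
  count (λ t → T? t ×-dec hits? t) S + count T? (seqs k (filter (avoids? ∘ first) C))
    ≡⟨ cong₂ _+_ refl avoiding-v ⟩
  count (λ t → T? t ×-dec hits? t) S + count (λ t → T? t ×-dec ¬? (hits? t)) S
    ≡⟨ count-split T? hits? S ⟨
  count T? S ∎
  where
  open ≡-Reasoning
  C = cells A (D ∷ Ds)
  S = seqs k C
  T? = isTable? _≟_ (R ∷ Rs)
  first : X × Vec ℕ (suc n) → ℕ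
  first c = lookup (proj₂ c) zero
  avoids? : Decidable (v ≢_)
  avoids? = ¬? ∘ (v ℕₚ.≟_)
  Hits : Vec (X × Vec ℕ (suc n)) k → Set
  Hits t = Any (λ c → lookup c zero ≡ v) (map proj₂ (toList t))
  hits? : Decidable Hits
  hits? t = Any.any? (λ c → lookup c zero ℕₚ.≟ v) (map proj₂ (toList t))
  covering-v : count (isTable? _≟_ ((v ∷ R) ∷ Rs)) S ≡ count (λ t → T? t ×-dec hits? t) S
  covering-v = count-cong _ _
    (λ (u , cov) → let cov′ , hit = Equivalence.to Covers-∷⇔ cov in (u , cov′) , hit)
    (λ ((u , cov′) , hit) → u , Equivalence.from Covers-∷⇔ (cov′ , hit))
    S
  avoiding-v : count T? (seqs k (filter (avoids? ∘ first) C)) ≡ count (λ t → T? t ×-dec ¬? (hits? t)) S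
  avoiding-v = count-seqs-filter (avoids? ∘ first) k C T? _ (mk⇔
    (λ (table , miss) → table , All.tabulate (λ c∈t v≡ → miss (Anyₚ.map⁺ (Any.map (λ { refl → sym v≡ }) c∈t))))
    (λ (table , avoid) → table , λ hit → let v≢ , ≡v = All.lookupAny avoid (Anyₚ.map⁻ hit) in v≢ (sym ≡v)))

m+n≡o⇒m≡o-n : ∀ {m n o} → m + n ≡ o → + m ≡ + o ℤ.- + n
m+n≡o⇒m≡o-n {m} {n} refl = trans (cancel (+ m) (+ n)) (cong (ℤ._- + n) (sym (ℤₚ.pos-+ m n)))
  where
  cancel : ∀ x y → x ≡ x ℤ.+ y ℤ.- y
  cancel = solve-∀

count-tables-[] : ∀ k (_≟_ : DecidableEquality X) {A : List X} → Unique A →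
                  count (isTable? _≟_ []) (seqs k (cells A [])) ≡ fall (length A) k
count-tables-[] k _≟_ {A} uA = begin
  count (isTable? _≟_ []) (seqs k (map (_, []) A))
    ≡⟨ count-cong _ (injective? (≡-dec-cell _≟_)) proj₁ (λ u → u , λ ()) (seqs k (map (_, []) A)) ⟩
  count (injective? (≡-dec-cell _≟_)) (seqs k (map (_, []) A))
    ≡⟨ count-injective-seqs (≡-dec-cell _≟_) k (Uniqueₚ.map⁺ (cong proj₁) uA) ⟩
  fall (length (map (_, []) A)) k
    ≡⟨ cong (λ m → fall m k) (Listₚ.length-map _ A) ⟩
  fall (length A) k ∎
  where open ≡-Reasoning

-- Each required slice value is removed by count-tables-split at the cost of one backward difference.
count-tables : ∀ {n} k (_≟_ : DecidableEquality X) {A : List X} → Unique A → (Rs Ds : Vec (List ℕ) n) →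
  VecAll.All Unique Ds → Pointwise (λ R D → Unique R × All (_∈ D) R) Rs Ds →
  + count (isTable? _≟_ Rs) (seqs k (cells A Ds))
    ≡ ∇ᵛ (λ ds → + fall (length A * prodℕ ds) k) (Vec.map length Rs) (Vec.map length Ds)
count-tables k _≟_ {A} uA [] [] _ _ =
  cong +_ (trans (count-tables-[] k _≟_ uA) (cong (λ m → fall m k) (sym (ℕₚ.*-identityʳ (length A)))))
count-tables k _≟_ {A} uA (R ∷ Rs) (D ∷ Ds) (uD VecAll.∷ uDs) ((uR , R⊆D) ∷ RDs) = go R D uR R⊆D uD
  where
  open ≡-Reasoning
  g : ℕ → ℤ
  g x = ∇ᵛ (λ ys → + fall (length A * (x * prodℕ ys)) k) (Vec.map length Rs) (Vec.map length Ds)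
  go : ∀ R D → Unique R → All (_∈ D) R → Unique D →
       + count (isTable? _≟_ (R ∷ Rs)) (seqs k (cells A (D ∷ Ds))) ≡ ∇ g (length R) (length D)
  go [] D _ _ uD = begin
    + count (isTable? _≟_ ([] ∷ Rs)) (seqs k (cells A (D ∷ Ds)))
      ≡⟨ cong +_ (count-tables-reassoc k _≟_ A D Rs Ds) ⟩
    + count (isTable? _≟′_ Rs) (seqs k (cells (cartesianProduct A D) Ds))
      ≡⟨ count-tables k _≟′_ (Uniqueₚ.cartesianProduct⁺ uA uD) Rs Ds uDs RDs ⟩
    ∇ᵛ (λ ds → + fall (length (cartesianProduct A D) * prodℕ ds) k) (Vec.map length Rs) (Vec.map length Ds)
      ≡⟨ ∇ᵛ-cong (λ ds → cong (λ m → + fall m k) (regroup ds)) (Vec.map length Rs) (Vec.map length Ds) ⟩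
    g (length D) ∎
    where
    _≟′_ = Productₚ.≡-dec _≟_ ℕₚ._≟_
    regroup : ∀ ds → length (cartesianProduct A D) * prodℕ ds ≡ length A * (length D * prodℕ ds)
    regroup ds = trans (cong (_* prodℕ ds) (length-cartesianProduct A D)) (ℕₚ.*-assoc (length A) _ _)
  go (v ∷ R) D (v∉R AllPairs.∷ uR) (v∈D ∷ R⊆D) uD = begin
    + count (isTable? _≟_ ((v ∷ R) ∷ Rs)) (seqs k (cells A (D ∷ Ds)))
      ≡⟨ m+n≡o⇒m≡o-n (count-tables-split k _≟_ A v R D Rs Ds) ⟩
    + count T? (seqs k (cells A (D ∷ Ds))) ℤ.- + count T? (seqs k (cells A (D-v ∷ Ds)))
      ≡⟨ cong₂ ℤ._-_ (go R D uR R⊆D uD) (go R D-v uR R⊆D-v (Uniqueₚ.filter⁺ (¬? ∘ (v ℕₚ.≟_)) uD)) ⟩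
    ∇ g (length R) (length D) ℤ.- ∇ g (length R) (length D-v)
      ≡⟨ cong (λ d → ∇ g (length R) (length D) ℤ.- ∇ g (length R) d) (length-filter-≢ ℕₚ._≟_ uD v∈D) ⟩
    ∇ g (suc (length R)) (length D) ∎
    where
    T? = isTable? _≟_ (R ∷ Rs)
    D-v = filter (¬? ∘ (v ℕₚ.≟_)) D
    R⊆D-v : All (_∈ D-v) R
    R⊆D-v = All.zipWith (λ (x∈D , v≢x) → ∈ₚ.∈-filter⁺ (¬? ∘ (v ℕₚ.≟_)) x∈D v≢x) (R⊆D , v∉R)

module _ {n} (L : Vec ℕ n) where

  private
    Slices = Vec.map upTo L

  length-slices : Vec.map length Slices ≡ L
  length-slices = trans (sym (Vecₚ.map-∘ length upTo L))
                        (trans (Vecₚ.map-cong Listₚ.length-upTo L) (Vecₚ.map-id L))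

  slices-unique : VecAll.All Unique Slices
  slices-unique = go L
    where
    go : ∀ {m} (L : Vec ℕ m) → VecAll.All Unique (Vec.map upTo L)
    go []      = VecAll.[]
    go (l ∷ L) = Uniqueₚ.upTo⁺ l VecAll.∷ go L

  slices-pointwise : Pointwise (λ R D → Unique R × All (_∈ D) R) Slices Slices
  slices-pointwise = go L
    where
    go : ∀ {m} (L : Vec ℕ m) → Pointwise (λ R D → Unique R × All (_∈ D) R) (Vec.map upTo L) (Vec.map upTo L)
    go []      = []
    go (l ∷ L) = (Uniqueₚ.upTo⁺ l , All.tabulate id) ∷ go L

  cells-slices : cells (tt ∷ []) Slices ≡ map (tt ,_) (vecsBelow L)
  cells-slices = trans (cells-vecsBelow (tt ∷ []) L) (Listₚ.++-identityʳ _)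

  vecsBelow-unique : Unique (vecsBelow L)
  vecsBelow-unique = Uniqueₚ.map⁻ (subst Unique cells-slices (cells-unique ([] AllPairs.∷ AllPairs.[]) slices-unique))

  length-vecsBelow : length (vecsBelow L) ≡ prodℕ L
  length-vecsBelow = begin
    length (vecsBelow L)                   ≡⟨ Listₚ.length-map (tt ,_) (vecsBelow L) ⟨
    length (map (tt ,_) (vecsBelow L))     ≡⟨ cong length cells-slices ⟨
    length (cells (tt ∷ []) Slices)        ≡⟨ length-cells (tt ∷ []) Slices ⟩
    1 * prodℕ (Vec.map length Slices)      ≡⟨ ℕₚ.*-identityˡ _ ⟩
    prodℕ (Vec.map length Slices)          ≡⟨ cong prodℕ length-slices ⟩
    prodℕ L                                ∎
    where open ≡-Reasoning

  IsRankingTable⇔IsTable : ∀ {k} {t : Vec (Vec ℕ n) k} → IsRankingTable L t ⇔ IsTable Slices (Vec.map (tt ,_) t)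
  IsRankingTable⇔IsTable {t = t} = mk⇔
    (λ (u , cov) → subst Unique (sym tagged) (Uniqueₚ.map⁺ (cong proj₂) u) ,
                   subst (Covers Slices) (sym untagged) (λ i → subst (All _) (sym (slice i)) (Allₚ.tabulate⁻ cov i)))
    (λ (u , cov) → Uniqueₚ.map⁻ (subst Unique tagged u) ,
                   Allₚ.tabulate⁺ (λ i → subst (All _) (slice i) (subst (Covers Slices) untagged cov i)))
    where
    tagged : toList (Vec.map (tt ,_) t) ≡ map (tt ,_) (toList t)
    tagged = Vecₚ.toList-map (tt ,_) t
    untagged : map proj₂ (toList (Vec.map (tt ,_) t)) ≡ toList t
    untagged = trans (cong (map proj₂) tagged) (trans (sym (Listₚ.map-∘ (toList t))) (Listₚ.map-id (toList t)))
    slice : ∀ i → lookup Slices i ≡ upTo (lookup L i)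
    slice i = Vecₚ.lookup-map i upTo L

  numRankingTables≡∇ᵛ : ∀ k → + numRankingTables k L ≡ ∇ᵛ (λ ds → + fall (prodℕ ds) k) L L
  numRankingTables≡∇ᵛ k = begin
    + length (filter (isRankingTable? L) (seqs k VB))
      ≡⟨ cong +_ (length-filter≡count (isRankingTable? L) (seqs k VB)) ⟩
    + count (isRankingTable? L) (seqs k VB)
      ≡⟨ cong +_ (count-cong (isRankingTable? L) (T? ∘ Vec.map (tt ,_))
                   (Equivalence.to IsRankingTable⇔IsTable) (Equivalence.from IsRankingTable⇔IsTable) (seqs k VB)) ⟩
    + count (T? ∘ Vec.map (tt ,_)) (seqs k VB)
      ≡⟨ cong +_ (count-map T? (Vec.map (tt ,_)) (seqs k VB)) ⟨
    + count T? (map (Vec.map (tt ,_)) (seqs k VB))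
      ≡⟨ cong (λ S → + count T? S) (trans (sym (seqs-map (tt ,_) k VB)) (cong (seqs k) (sym cells-slices))) ⟩
    + count T? (seqs k (cells (tt ∷ []) Slices))
      ≡⟨ count-tables k Unitₚ._≟_ ([] AllPairs.∷ AllPairs.[]) Slices Slices slices-unique slices-pointwise ⟩
    ∇ᵛ (λ ds → + fall (1 * prodℕ ds) k) (Vec.map length Slices) (Vec.map length Slices)
      ≡⟨ cong₂ (∇ᵛ (λ ds → + fall (1 * prodℕ ds) k)) length-slices length-slices ⟩
    ∇ᵛ (λ ds → + fall (1 * prodℕ ds) k) L L
      ≡⟨ ∇ᵛ-cong (λ ds → cong (λ m → + fall m k) (ℕₚ.*-identityˡ (prodℕ ds))) L L ⟩
    ∇ᵛ (λ ds → + fall (prodℕ ds) k) L L ∎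
    where
    open ≡-Reasoning
    VB = vecsBelow L
    T? = isTable? Unitₚ._≟_ Slices

sumℤ-cong : ∀ {f g : A → ℤ} → (∀ x → f x ≡ g x) → ∀ xs → sumℤ (map f xs) ≡ sumℤ (map g xs)
sumℤ-cong f≗g xs = cong sumℤ (Listₚ.map-cong f≗g xs)

sumℤ-++ : ∀ xs ys → sumℤ (xs ++ ys) ≡ sumℤ xs ℤ.+ sumℤ ys
sumℤ-++ []       ys = sym (ℤₚ.+-identityˡ _)
sumℤ-++ (x ∷ xs) ys = trans (cong₂ ℤ._+_ (refl {x = x}) (sumℤ-++ xs ys)) (sym (ℤₚ.+-assoc x _ _))

sumℤ-concatMap : (F : B → ℤ) (g : A → List B) → ∀ xs →
                 sumℤ (map F (concatMap g xs)) ≡ sumℤ (map (λ x → sumℤ (map F (g x))) xs)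
sumℤ-concatMap F g []       = refl
sumℤ-concatMap F g (x ∷ xs) = begin
  sumℤ (map F (g x ++ concatMap g xs))                 ≡⟨ cong sumℤ (Listₚ.map-++ F (g x) _) ⟩
  sumℤ (map F (g x) ++ map F (concatMap g xs))         ≡⟨ sumℤ-++ (map F (g x)) _ ⟩
  sumℤ (map F (g x)) ℤ.+ sumℤ (map F (concatMap g xs)) ≡⟨ cong (λ z → sumℤ (map F (g x)) ℤ.+ z) (sumℤ-concatMap F g xs) ⟩
  sumℤ (map F (g x)) ℤ.+ sumℤ (map (λ x → sumℤ (map F (g x))) xs) ∎
  where open ≡-Reasoning

sumℤ-+ : (f g : A → ℤ) → ∀ xs → sumℤ (map (λ x → f x ℤ.+ g x) xs) ≡ sumℤ (map f xs) ℤ.+ sumℤ (map g xs)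
sumℤ-+ f g []       = refl
sumℤ-+ f g (x ∷ xs) = trans (cong (λ z → f x ℤ.+ g x ℤ.+ z) (sumℤ-+ f g xs)) (interchange (f x) (g x) _ _)
  where
  interchange : ∀ a b c d → a ℤ.+ b ℤ.+ (c ℤ.+ d) ≡ a ℤ.+ c ℤ.+ (b ℤ.+ d)
  interchange = solve-∀

sumℤ-*ˡ : ∀ a (f : A → ℤ) xs → a ℤ.* sumℤ (map f xs) ≡ sumℤ (map (λ x → a ℤ.* f x) xs)
sumℤ-*ˡ a f []       = ℤₚ.*-zeroʳ a
sumℤ-*ˡ a f (x ∷ xs) = trans (ℤₚ.*-distribˡ-+ a (f x) _) (cong (λ z → a ℤ.* f x ℤ.+ z) (sumℤ-*ˡ a f xs))

sumℤ-*ʳ : ∀ a (f : A → ℤ) xs → sumℤ (map f xs) ℤ.* a ≡ sumℤ (map (λ x → f x ℤ.* a) xs)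
sumℤ-*ʳ a f xs =
  trans (ℤₚ.*-comm _ a) (trans (sumℤ-*ˡ a f xs) (sumℤ-cong (λ x → ℤₚ.*-comm a (f x)) xs))

sumℤ-0 : (f : A → ℤ) → ∀ {xs} → All (λ x → f x ≡ + 0) xs → sumℤ (map f xs) ≡ + 0
sumℤ-0 f []       = refl
sumℤ-0 f (e ∷ es) = cong₂ ℤ._+_ e (sumℤ-0 f es)

sumℤ-single : (f : A → ℤ) → ∀ {x xs} → Unique xs → x ∈ xs → (∀ {y} → y ≢ x → f y ≡ + 0) →
              sumℤ (map f xs) ≡ f x
sumℤ-single f {x} (x∉ AllPairs.∷ _) (here refl) others =
  trans (cong (λ z → f x ℤ.+ z) (sumℤ-0 f (All.map (λ x≢ → others (x≢ ∘ sym)) x∉))) (ℤₚ.+-identityʳ (f x))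
sumℤ-single f {xs = y ∷ ys} (y∉ AllPairs.∷ u) (there x∈) others =
  trans (cong₂ ℤ._+_ (others (λ { refl → All.lookup y∉ x∈ refl })) (sumℤ-single f u x∈ others))
        (ℤₚ.+-identityˡ _)

-- Reading off coefficients

∈-vecsBelow⁺ : ∀ {n} {L B : Vec ℕ n} → Pointwise _<_ L B → L ∈ vecsBelow B
∈-vecsBelow⁺ []                      = here refl
∈-vecsBelow⁺ {L = l ∷ L} {b ∷ B} (l<b ∷ L<B) =
  ∈ₚ.∈-concat⁺′ (∈ₚ.∈-map⁺ (l ∷_) (∈-vecsBelow⁺ L<B)) (∈ₚ.∈-map⁺ (λ v → map (v ∷_) (vecsBelow B)) (∈ₚ.∈-upTo⁺ l<b))

∈-vecsBelow⁻ : ∀ {n} {L B : Vec ℕ n} → L ∈ vecsBelow B → Pointwise _<_ L B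
∈-vecsBelow⁻ {L = []}    {[]}    _  = []
∈-vecsBelow⁻ {L = l ∷ L} {b ∷ B} L∈ with ∈ₚ.∈-concat⁻′ (map (λ v → map (v ∷_) (vecsBelow B)) (upTo b)) L∈
... | _ , L∈row , row∈ with ∈ₚ.∈-map⁻ (λ v → map (v ∷_) (vecsBelow B)) row∈
... | v , v∈ , refl with ∈ₚ.∈-map⁻ (v ∷_) L∈row
... | _ , L∈B , refl = ∈ₚ.∈-upTo⁻ v∈ ∷ ∈-vecsBelow⁻ L∈B

∇ᵛ-expansion : ∀ {n k c} → IsExpansion n k c → ∀ {L} → Pointwise _<_ L (Vec.replicate n (suc k)) →
               ∇ᵛ (λ ds → + fall (prodℕ ds) k) L L ≡ c L ℤ.* + prodℕ (Vec.map _! L)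
∇ᵛ-expansion {n} {k} {c} expansion {L} L<k = begin
  ∇ᵛ (λ ds → + fall (prodℕ ds) k) L L
    ≡⟨ ∇ᵛ-cong expansion L L ⟩
  ∇ᵛ (λ ds → sumℤ (map (λ M → c M ℤ.* + monomial ds M) G)) L L
    ≡⟨ ∇ᵛ-sum (λ M ds → c M ℤ.* + monomial ds M) G L L ⟩
  sumℤ (map (λ M → ∇ᵛ (λ ds → c M ℤ.* + monomial ds M) L L) G)
    ≡⟨ sumℤ-cong (λ M → ∇ᵛ-*ˡ (c M) _ L L) G ⟩
  sumℤ (map (λ M → c M ℤ.* ∇ᵛ (λ ds → + monomial ds M) L L) G)
    ≡⟨ sumℤ-single (λ M → c M ℤ.* ∇ᵛ (λ ds → + monomial ds M) L L) (vecsBelow-unique (Vec.replicate n (suc k))) (∈-vecsBelow⁺ L<k)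
         (λ {M} M≢L → trans (cong (c M ℤ.*_) (∇ᵛ-monomial-other M≢L)) (ℤₚ.*-zeroʳ (c M))) ⟩
  c L ℤ.* ∇ᵛ (λ ds → + monomial ds L) L L
    ≡⟨ cong (c L ℤ.*_) (∇ᵛ-monomial-self L) ⟩
  c L ℤ.* + prodℕ (Vec.map _! L) ∎
  where
  open ≡-Reasoning
  G = grid n k

-- Existence of falling-factorial expansions

record Expansion {n} (B : Vec ℕ n) (f : Vec ℕ n → ℤ) : Set where
  field
    coeff   : Vec ℕ n → ℤ
    expands : ∀ x → f x ≡ sumℤ (map (λ M → coeff M ℤ.* + monomial x M) (vecsBelow B))

open Expansion

module _ {n} {B : Vec ℕ n} where

  expansion-cong : ∀ {f g} → (∀ x → f x ≡ g x) → Expansion B f → Expansion B g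
  expansion-cong f≗g e = record { coeff = coeff e ; expands = λ x → trans (sym (f≗g x)) (expands e x) }

  expansion-+ : ∀ {f g} → Expansion B f → Expansion B g → Expansion B (λ x → f x ℤ.+ g x)
  expansion-+ ef eg = record
    { coeff   = λ M → coeff ef M ℤ.+ coeff eg M
    ; expands = λ x → trans (cong₂ ℤ._+_ (expands ef x) (expands eg x)) (trans (sym (sumℤ-+ _ _ (vecsBelow B)))
        (sumℤ-cong (λ M → sym (ℤₚ.*-distribʳ-+ (+ monomial x M) (coeff ef M) (coeff eg M))) (vecsBelow B)))
    }

  expansion-*ˡ : ∀ {f} a → Expansion B f → Expansion B (λ x → a ℤ.* f x)
  expansion-*ˡ a e = record
    { coeff   = λ M → a ℤ.* coeff e M
    ; expands = λ x → trans (cong (a ℤ.*_) (expands e x)) (trans (sumℤ-*ˡ a _ (vecsBelow B))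
        (sumℤ-cong (λ M → sym (ℤₚ.*-assoc a (coeff e M) _)) (vecsBelow B)))
    }

  expansion-0 : Expansion B (λ _ → + 0)
  expansion-0 = record
    { coeff = λ _ → + 0 ; expands = λ x → sym (sumℤ-0 _ (All.universal (λ _ → refl) (vecsBelow B))) }

  expansion-sum : (F : A → Vec ℕ n → ℤ) → ∀ {js} → All (λ j → Expansion B (F j)) js →
                  Expansion B (λ x → sumℤ (map (λ j → F j x) js))
  expansion-sum F []       = expansion-0
  expansion-sum F (e ∷ es) = expansion-+ e (expansion-sum F es)

  expansion-monomial : ∀ {L} → Pointwise _<_ L B → Expansion B (λ x → + monomial x L)
  expansion-monomial {L} L<B = record
    { coeff   = δ
    ; expands = λ x → sym (trans (sumℤ-single _ (vecsBelow-unique B) (∈-vecsBelow⁺ L<B) (off-L {x})) (on-L x))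
    }
    where
    δ : Vec ℕ n → ℤ
    δ M with Vecₚ.≡-dec ℕₚ._≟_ M L
    ... | yes _ = + 1
    ... | no  _ = + 0
    off-L : ∀ {x M} → M ≢ L → δ M ℤ.* + monomial x M ≡ + 0
    off-L {M = M} M≢L with Vecₚ.≡-dec ℕₚ._≟_ M L
    ... | yes M≡L = ⊥-elim (M≢L M≡L)
    ... | no  _   = refl
    on-L : ∀ x → δ L ℤ.* + monomial x L ≡ + monomial x L
    on-L x with Vecₚ.≡-dec ℕₚ._≟_ L L
    ... | yes _   = ℤₚ.*-identityˡ _
    ... | no  L≢L = ⊥-elim (L≢L refl)

sumℤ-vecsBelow-∷ : ∀ {n} (F : Vec ℕ (suc n) → ℤ) b (B : Vec ℕ n) →
  sumℤ (map F (vecsBelow (b ∷ B))) ≡ sumℤ (map (λ v → sumℤ (map (F ∘ (v ∷_)) (vecsBelow B))) (upTo b))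
sumℤ-vecsBelow-∷ F b B = trans (sumℤ-concatMap F (λ v → map (v ∷_) (vecsBelow B)) (upTo b))
  (sumℤ-cong (λ v → cong sumℤ (sym (Listₚ.map-∘ (vecsBelow B)))) (upTo b))

expands-one-variable : ∀ {b f} (e : Expansion (b ∷ []) f) y →
                       f (y ∷ []) ≡ sumℤ (map (λ v → coeff e (v ∷ []) ℤ.* + fall y v) (upTo b))
expands-one-variable {b} {f} e y = begin
  f (y ∷ [])
    ≡⟨ expands e (y ∷ []) ⟩
  sumℤ (map (λ V → coeff e V ℤ.* + monomial (y ∷ []) V) (vecsBelow (b ∷ [])))
    ≡⟨ sumℤ-vecsBelow-∷ _ b [] ⟩
  sumℤ (map (λ v → coeff e (v ∷ []) ℤ.* + (fall y v * 1) ℤ.+ + 0) (upTo b))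
    ≡⟨ sumℤ-cong (λ v → trans (ℤₚ.+-identityʳ _) (cong (λ m → coeff e (v ∷ []) ℤ.* + m) (ℕₚ.*-identityʳ (fall y v)))) (upTo b) ⟩
  sumℤ (map (λ v → coeff e (v ∷ []) ℤ.* + fall y v) (upTo b)) ∎
  where open ≡-Reasoning

expansion-⊗ : ∀ {n} {b} {B : Vec ℕ n} {f g} → Expansion (b ∷ []) f → Expansion B g →
              Expansion (b ∷ B) (λ x → f (Vec.head x ∷ []) ℤ.* g (Vec.tail x))
expansion-⊗ {b = b} {B} {f} {g} ef eg = record
  { coeff   = λ M → coeff ef (Vec.head M ∷ []) ℤ.* coeff eg (Vec.tail M)
  ; expands = λ { (y ∷ ys) → sym (begin
      sumℤ (map (λ M → cf (Vec.head M) ℤ.* cg (Vec.tail M) ℤ.* + monomial (y ∷ ys) M) (vecsBelow (b ∷ B)))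
        ≡⟨ sumℤ-vecsBelow-∷ _ b B ⟩
      sumℤ (map (λ v → sumℤ (map (λ N → cf v ℤ.* cg N ℤ.* + (fall y v * monomial ys N)) (vecsBelow B))) (upTo b))
        ≡⟨ sumℤ-cong (λ v → factor y ys v) (upTo b) ⟩
      sumℤ (map (λ v → cf v ℤ.* + fall y v ℤ.* g ys) (upTo b))
        ≡⟨ sumℤ-*ʳ (g ys) _ (upTo b) ⟨
      sumℤ (map (λ v → cf v ℤ.* + fall y v) (upTo b)) ℤ.* g ys
        ≡⟨ cong (ℤ._* g ys) (expands-one-variable ef y) ⟨
      f (y ∷ []) ℤ.* g ys ∎) }
  }
  where
  open ≡-Reasoning
  cf : ℕ → ℤ
  cf v = coeff ef (v ∷ [])
  cg = coeff eg
  factor : ∀ y ys v → sumℤ (map (λ N → cf v ℤ.* cg N ℤ.* + (fall y v * monomial ys N)) (vecsBelow B))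
                      ≡ cf v ℤ.* + fall y v ℤ.* g ys
  factor y ys v = begin
    sumℤ (map (λ N → cf v ℤ.* cg N ℤ.* + (fall y v * monomial ys N)) (vecsBelow B))
      ≡⟨ sumℤ-cong (λ N → trans (cong (cf v ℤ.* cg N ℤ.*_) (ℤₚ.pos-* (fall y v) _)) (swap (cf v) (cg N) _ _)) (vecsBelow B) ⟩
    sumℤ (map (λ N → cf v ℤ.* + fall y v ℤ.* (cg N ℤ.* + monomial ys N)) (vecsBelow B))
      ≡⟨ sumℤ-*ˡ (cf v ℤ.* + fall y v) _ (vecsBelow B) ⟨
    cf v ℤ.* + fall y v ℤ.* sumℤ (map (λ N → cg N ℤ.* + monomial ys N) (vecsBelow B))
      ≡⟨ cong (cf v ℤ.* + fall y v ℤ.*_) (expands eg ys) ⟨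
    cf v ℤ.* + fall y v ℤ.* g ys ∎
    where
    swap : ∀ a b c d → a ℤ.* b ℤ.* (c ℤ.* d) ≡ a ℤ.* c ℤ.* (b ℤ.* d)
    swap = solve-∀

fall*base : ∀ y m → fall y m * y ≡ fall y (suc m) + m * fall y m
fall*base y m with ℕₚ.≤-<-connex m y
... | inj₁ m≤y = begin
  fall y m * y                          ≡⟨ cong (fall y m *_) (ℕₚ.m∸n+n≡m m≤y) ⟨
  fall y m * ((y ∸ m) + m)              ≡⟨ ℕₚ.*-distribˡ-+ (fall y m) (y ∸ m) m ⟩
  fall y m * (y ∸ m) + fall y m * m     ≡⟨ cong₂ _+_ refl (ℕₚ.*-comm (fall y m) m) ⟩
  fall y (suc m) + m * fall y m         ∎
  where open ≡-Reasoning
... | inj₂ y<m = begin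
  fall y m * y                          ≡⟨ cong (_* y) (fall-< y<m) ⟩
  0                                     ≡⟨ ℕₚ.*-zeroʳ m ⟨
  m * 0                                 ≡⟨ cong₂ (λ a b → a * (y ∸ m) + m * b) (fall-< y<m) (fall-< y<m) ⟨
  fall y (suc m) + m * fall y m         ∎
  where open ≡-Reasoning

<-weaken : ∀ {n} {M B : Vec ℕ n} → Pointwise _<_ M B → Pointwise _<_ M (Vec.map suc B)
<-weaken []            = []
<-weaken (m<b ∷ M<B) = ℕₚ.m≤n⇒m≤1+n m<b ∷ <-weaken M<B

expansion-monomial*prod : ∀ {n} {M B : Vec ℕ n} → Pointwise _<_ M B →
                          Expansion (Vec.map suc B) (λ x → + (monomial x M * prodℕ x))
expansion-monomial*prod {M = []}    []            = expansion-cong (λ { [] → refl }) (expansion-monomial {B = []} {L = []} [])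
expansion-monomial*prod {M = m ∷ M} (m<b ∷ M<B) =
  expansion-cong split (expansion-⊗ times-base (expansion-monomial*prod M<B))
  where
  times-base : Expansion (suc _ ∷ []) (λ v → + (fall (Vec.head v) m * Vec.head v))
  times-base = expansion-cong (λ { (y ∷ []) → unit y })
    (expansion-+ (expansion-monomial (s≤s m<b ∷ [])) (expansion-*ˡ (+ m) (expansion-monomial (ℕₚ.m≤n⇒m≤1+n m<b ∷ []))))
    where
    unit : ∀ y → + (fall y (suc m) * 1) ℤ.+ + m ℤ.* + (fall y m * 1) ≡ + (fall y m * y)
    unit y = begin
      + (fall y (suc m) * 1) ℤ.+ + m ℤ.* + (fall y m * 1)
        ≡⟨ cong₂ (λ a b → + a ℤ.+ + m ℤ.* + b) (ℕₚ.*-identityʳ _) (ℕₚ.*-identityʳ _) ⟩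
      + fall y (suc m) ℤ.+ + m ℤ.* + fall y m
        ≡⟨ cong (λ z → + fall y (suc m) ℤ.+ z) (ℤₚ.pos-* m (fall y m)) ⟨
      + (fall y (suc m) + m * fall y m)
        ≡⟨ cong +_ (fall*base y m) ⟨
      + (fall y m * y) ∎
      where open ≡-Reasoning
  split : ∀ x → + (fall (Vec.head x) m * Vec.head x) ℤ.* + (monomial (Vec.tail x) M * prodℕ (Vec.tail x))
                ≡ + (monomial x (m ∷ M) * prodℕ x)
  split (y ∷ ys) = trans (sym (ℤₚ.pos-* (fall y m * y) _)) (cong +_ (interchange (fall y m) y (monomial ys M) _))
    where
    interchange : ∀ a b c d → a * b * (c * d) ≡ a * c * (b * d)
    interchange = ℕsolve-∀

pos-fall-suc : ∀ P k → + fall P (suc k) ≡ + fall P k ℤ.* (+ P ℤ.- + k)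
pos-fall-suc P k with ℕₚ.≤-<-connex k P
... | inj₁ k≤P = trans (ℤₚ.pos-* (fall P k) (P ∸ k))
                       (cong (+ fall P k ℤ.*_) (sym (trans (ℤₚ.m-n≡m⊖n P k) (ℤₚ.⊖-≥ k≤P))))
... | inj₂ P<k = trans (cong (λ z → + (z * (P ∸ k))) (fall-< P<k))
                       (cong (λ z → + z ℤ.* (+ P ℤ.- + k)) (sym (fall-< P<k)))

monomial-zeros : ∀ {n} (x : Vec ℕ n) → monomial x (Vec.replicate n 0) ≡ 1
monomial-zeros []       = refl
monomial-zeros (y ∷ ys) = trans (ℕₚ.*-identityˡ _) (monomial-zeros ys)

zeros<ones : ∀ n → Pointwise _<_ (Vec.replicate n 0) (Vec.replicate n 1)
zeros<ones zero    = []
zeros<ones (suc n) = s≤s z≤n ∷ zeros<ones n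

expansion-fall-prod : ∀ n k → Expansion (Vec.replicate n (suc k)) (λ x → + fall (prodℕ x) k)
expansion-fall-prod n zero    = expansion-cong (λ x → cong +_ (monomial-zeros x)) (expansion-monomial (zeros<ones n))
expansion-fall-prod n (suc k) =
  subst (λ B → Expansion B (λ x → + fall (prodℕ x) (suc k))) (Vecₚ.map-replicate suc (suc k) n)
    (expansion-cong multiply (expansion-sum F (All.tabulate term)))
  where
  e = expansion-fall-prod n k
  G = grid n k
  F : Vec ℕ n → Vec ℕ n → ℤ
  F M x = coeff e M ℤ.* (+ (monomial x M * prodℕ x) ℤ.+ ℤ.- + k ℤ.* + monomial x M)
  term : ∀ {M} → M ∈ G → Expansion (Vec.map suc (Vec.replicate n (suc k))) (F M)
  term {M} M∈G = expansion-*ˡ (coeff e M)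
    (expansion-+ (expansion-monomial*prod M<) (expansion-*ˡ (ℤ.- + k) (expansion-monomial (<-weaken M<))))
    where M< = ∈-vecsBelow⁻ M∈G
  multiply : ∀ x → sumℤ (map (λ M → F M x) G) ≡ + fall (prodℕ x) (suc k)
  multiply x = sym (begin
    + fall (prodℕ x) (suc k)
      ≡⟨ pos-fall-suc (prodℕ x) k ⟩
    + fall (prodℕ x) k ℤ.* (+ prodℕ x ℤ.- + k)
      ≡⟨ cong (ℤ._* (+ prodℕ x ℤ.- + k)) (expands e x) ⟩
    sumℤ (map (λ M → coeff e M ℤ.* + monomial x M) G) ℤ.* (+ prodℕ x ℤ.- + k)
      ≡⟨ sumℤ-*ʳ _ _ G ⟩
    sumℤ (map (λ M → coeff e M ℤ.* + monomial x M ℤ.* (+ prodℕ x ℤ.- + k)) G)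
      ≡⟨ sumℤ-cong (λ M → trans (distribute (coeff e M) (+ monomial x M) (+ prodℕ x) (+ k))
                               (cong (λ z → coeff e M ℤ.* (z ℤ.+ ℤ.- + k ℤ.* + monomial x M))
                                     (sym (ℤₚ.pos-* (monomial x M) (prodℕ x))))) G ⟩
    sumℤ (map (λ M → F M x) G) ∎)
    where
    open ≡-Reasoning
    distribute : ∀ c m p q → c ℤ.* m ℤ.* (p ℤ.- q) ≡ c ℤ.* (m ℤ.* p ℤ.+ ℤ.- q ℤ.* m)
    distribute = solve-∀

-- Bounds on the number of ranking tables

numRankingTables≤fall : ∀ {n} k (L : Vec ℕ n) → numRankingTables k L ≤ fall (prodℕ L) k
numRankingTables≤fall k L = begin
  length (filter (isRankingTable? L) (seqs k VB))  ≡⟨ length-filter≡count (isRankingTable? L) (seqs k VB) ⟩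
  count (isRankingTable? L) (seqs k VB)            ≤⟨ count-mono (isRankingTable? L) (injective? _≟ᵛ_) proj₁ (seqs k VB) ⟩
  count (injective? _≟ᵛ_) (seqs k VB)                ≡⟨ count-injective-seqs _≟ᵛ_ k (vecsBelow-unique L) ⟩
  fall (length VB) k                               ≡⟨ cong (λ m → fall m k) (length-vecsBelow L) ⟩
  fall (prodℕ L) k                                 ∎
  where
  open ℕₚ.≤-Reasoning
  VB = vecsBelow L

RankingTable : ∀ {n} → Vec ℕ n → ℕ → Set
RankingTable {n} L j = Σ[ t ∈ Vec (Vec ℕ n) j ] AllV (_∈ vecsBelow L) t × IsRankingTable L t

numRankingTables-pos : ∀ {n} {k} {L : Vec ℕ n} → RankingTable L k → 0 < numRankingTables k L
numRankingTables-pos {k = k} {L} (t , t⊆ , table) =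
  subst (0 <_) (sym (length-filter≡count (isRankingTable? L) (seqs k (vecsBelow L))))
        (count-pos (isRankingTable? L) (∈-seqs k t t⊆) table)

unique⊆⇒length≤ : DecidableEquality A → ∀ {xs ys : List A} → Unique xs → All (_∈ ys) xs → length xs ≤ length ys
unique⊆⇒length≤ _≟_ {[]}     _                 _           = z≤n
unique⊆⇒length≤ _≟_ {x ∷ xs} {ys} (x∉ AllPairs.∷ u) (x∈ ∷ xs⊆) =
  ℕₚ.≤-trans (s≤s (unique⊆⇒length≤ _≟_ u xs⊆ys-x))
             (Listₚ.filter-notAll (_≢?_ _≟_ x) ys (Any.map (λ x≡ x≢ → x≢ x≡) x∈))
  where
  xs⊆ys-x : All (_∈ filter (_≢?_ _≟_ x) ys) xs
  xs⊆ys-x = All.zipWith (λ (y∈ , x≢y) → ∈ₚ.∈-filter⁺ (_≢?_ _≟_ x) y∈ x≢y) (xs⊆ , x∉)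

missing-cell : ∀ {n} {L : Vec ℕ n} (cs : List (Vec ℕ n)) → length cs < prodℕ L →
               ∃ λ c → c ∈ vecsBelow L × c ∉ cs
missing-cell {L = L} cs short with All.all? (λ c → Any.any? (c ≟ᵛ_) cs) (vecsBelow L)
... | yes full = ⊥-elim (ℕₚ.<⇒≱ short (begin
  prodℕ L               ≡⟨ length-vecsBelow L ⟨
  length (vecsBelow L)  ≤⟨ unique⊆⇒length≤ _≟ᵛ_ (vecsBelow-unique L) full ⟩
  length cs             ∎))
  where open ℕₚ.≤-Reasoning
... | no ¬full = find (Allₚ.¬All⇒Any¬ (λ c → Any.any? (c ≟ᵛ_) cs) (vecsBelow L) ¬full)

extend-ranking-table : ∀ {n} {L : Vec ℕ n} {j} → j < prodℕ L → RankingTable L j → RankingTable L (suc j)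
extend-ranking-table {L = L} j<∏L (t , t⊆ , u , cov) =
  let c , c∈ , c∉t = missing-cell {L = L} (toList t) (subst (_< prodℕ L) (sym (Vecₚ.length-toList t)) j<∏L) in
  c ∷ t , c∈ ∷ t⊆ ,
  All.tabulate (λ c′∈t c≡c′ → c∉t (subst (_∈ toList t) (sym c≡c′) c′∈t)) AllPairs.∷ u ,
  All.map (All.map there) cov

module Diagonal {n} (L : Vec ℕ (suc n)) (L-pos : VecAll.All (1 ≤_) L) where

  p : Fin (suc n)
  p = argmax (lookup L) zero (allFin (suc n))

  m : ℕ
  m = lookup L p

  ≤m : ∀ i → lookup L i ≤ m
  ≤m i = All.lookup (f[xs]≤f[argmax] {f = lookup L} zero (allFin (suc n))) (∈ₚ.∈-allFin i)

  cell : ℕ → Vec ℕ (suc n)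
  cell j = Vec.map (λ l → j ⊓ pred l) L

  lookup-cell : ∀ {i j} → j < lookup L i → lookup (cell j) i ≡ j
  lookup-cell {i} {j} j<l = trans (Vecₚ.lookup-map i _ L) (ℕₚ.m≤n⇒m⊓n≡m (ℕₚ.pred-mono-≤ j<l))

  cell∈vecsBelow : ∀ j → cell j ∈ vecsBelow L
  cell∈vecsBelow j = ∈-vecsBelow⁺ (go L-pos)
    where
    go : ∀ {n′} {L′ : Vec ℕ n′} → VecAll.All (1 ≤_) L′ → Pointwise _<_ (Vec.map (λ l → j ⊓ pred l) L′) L′
    go VecAll.[]                           = []
    go {L′ = suc l ∷ _} (_ VecAll.∷ pos) = s≤s (ℕₚ.m⊓n≤n j l) ∷ go pos

  diagonal : ∀ j → Vec (Vec ℕ (suc n)) j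
  diagonal zero    = []
  diagonal (suc j) = cell j ∷ diagonal j

  ∈-diagonal⁺ : ∀ {i j} → i < j → cell i ∈ toList (diagonal j)
  ∈-diagonal⁺ {i} {suc j} (s≤s i≤j) with ℕₚ.m≤n⇒m<n∨m≡n i≤j
  ... | inj₁ i<j  = there (∈-diagonal⁺ i<j)
  ... | inj₂ refl = here refl

  ∈-diagonal⁻ : ∀ {j c} → c ∈ toList (diagonal j) → ∃ λ i → i < j × c ≡ cell i
  ∈-diagonal⁻ {suc j} (here c≡)  = j , ℕₚ.≤-refl , c≡
  ∈-diagonal⁻ {suc j} (there c∈) = let i , i<j , c≡ = ∈-diagonal⁻ c∈ in i , ℕₚ.m≤n⇒m≤1+n i<j , c≡

  -- Distinct cells of the diagonal differ in the coordinate p, where lₚ = m is largest.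
  diagonal-unique : ∀ {j} → j ≤ m → Unique (toList (diagonal j))
  diagonal-unique {zero}  _    = AllPairs.[]
  diagonal-unique {suc j} j<m = All.tabulate distinct AllPairs.∷ diagonal-unique (ℕₚ.<⇒≤ j<m)
    where
    distinct : ∀ {c} → c ∈ toList (diagonal j) → cell j ≢ c
    distinct c∈ cj≡c with ∈-diagonal⁻ c∈
    ... | i , i<j , refl = ℕₚ.<-irrefl (sym (begin
      j                 ≡⟨ lookup-cell j<m ⟨
      lookup (cell j) p ≡⟨ cong (λ c → lookup c p) cj≡c ⟩
      lookup (cell i) p ≡⟨ lookup-cell (ℕₚ.<-trans i<j j<m) ⟩
      i                 ∎)) i<j
      where open ≡-Reasoning

  diagonal-ranking-table : RankingTable L m
  diagonal-ranking-table =
    diagonal m , diagonal⊆ m , diagonal-unique ℕₚ.≤-refl ,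
    Allₚ.tabulate⁺ (λ i → All.tabulate (λ v∈ → let v<l = ∈ₚ.∈-upTo⁻ v∈ in
      Any.map (λ { refl → lookup-cell v<l }) (∈-diagonal⁺ (ℕₚ.<-≤-trans v<l (≤m i)))))
    where
    diagonal⊆ : ∀ j → AllV (_∈ vecsBelow L) (diagonal j)
    diagonal⊆ zero    = []
    diagonal⊆ (suc j) = cell∈vecsBelow j ∷ diagonal⊆ j

  ranking-table : ∀ {j} → m ≤ j → j ≤ prodℕ L → RankingTable L j
  ranking-table {j} m≤j j≤∏L with ℕₚ.m≤n⇒m<n∨m≡n m≤j
  ... | inj₂ refl = diagonal-ranking-table
  ... | inj₁ m<j with j
  ...   | suc j′ = extend-ranking-table {L = L} j≤∏L (ranking-table (ℕₚ.≤-pred m<j) (ℕₚ.<⇒≤ j≤∏L))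

numRankingTables-vanish : ∀ {n k} {L : Vec ℕ n} → prodℕ L < k → numRankingTables k L ≡ 0
numRankingTables-vanish {k = k} {L} ∏L<k =
  ℕₚ.n≤0⇒n≡0 (subst (numRankingTables k L ≤_) (fall-< ∏L<k) (numRankingTables≤fall k L))

numRankingTables-positive : ∀ {n k} {L : Vec ℕ (suc n)} → VecAll.All (λ l → 1 ≤ l × l ≤ k) L →
                            k ≤ prodℕ L → 0 < numRankingTables k L
numRankingTables-positive {L = L} L-bounds k≤∏L = numRankingTables-pos {L = L}
  (ranking-table (proj₂ (VecAllₚ.lookup⁺ L-bounds p)) k≤∏L)
  where open Diagonal L (VecAll.map proj₁ L-bounds)

All⇒<replicate : ∀ {n b} {L : Vec ℕ n} → VecAll.All (_< b) L → Pointwise _<_ L (Vec.replicate n b)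
All⇒<replicate VecAll.[]           = []
All⇒<replicate (l<b VecAll.∷ L<b) = l<b ∷ All⇒<replicate L<b

coefficient-counts-tables : ∀ {n k} c → IsExpansion n k c → ∀ {L : Vec ℕ n} → VecAll.All (_≤ k) L →
                            + prodℕ (Vec.map _! L) ℤ.* c L ≡ + numRankingTables k L
coefficient-counts-tables {k = k} c expansion {L} L≤k = begin
  + F ℤ.* c L                          ≡⟨ ℤₚ.*-comm (+ F) (c L) ⟩
  c L ℤ.* + F                          ≡⟨ ∇ᵛ-expansion {c = c} expansion (All⇒<replicate (VecAll.map s≤s L≤k)) ⟨
  ∇ᵛ (λ ds → + fall (prodℕ ds) k) L L  ≡⟨ numRankingTables≡∇ᵛ L k ⟨
  + numRankingTables k L               ∎
  where
  open ≡-Reasoning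
  F = prodℕ (Vec.map _! L)

prod-factorials≢0 : ∀ {n} (L : Vec ℕ n) → NonZero (prodℕ (Vec.map _! L))
prod-factorials≢0 []      = _
prod-factorials≢0 (l ∷ L) = ℕₚ.m*n≢0 (l !) _ {{l ℕₚ.!≢0}} {{prod-factorials≢0 L}}

pos-*-≡0 : ∀ a .{{_ : NonZero a}} {x} → + a ℤ.* x ≡ + 0 → x ≡ + 0
pos-*-≡0 a {x} ax≡0 = ℤₚ.*-cancelˡ-≡ (+ a) x (+ 0) (trans ax≡0 (sym (ℤₚ.*-zeroʳ (+ a))))

pos-*-pos : ∀ a {x t} → + a ℤ.* x ≡ + t → 0 < t → + 0 ℤ.< x
pos-*-pos a ax≡t 0<t = ℤₚ.*-cancelˡ-<-nonNeg (+ a) (subst₂ ℤ._<_ (sym (ℤₚ.*-zeroʳ (+ a))) (sym ax≡t) (ℤ.+<+ 0<t))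

-- The hypothesis 1 ≤ k is implied by 1 ≤ l ≤ k for the first entry of L.
mainTheorem10 : (n k : ℕ) (L : Vec ℕ n) → 1 ≤ n → 1 ≤ k →
    VecAll.All (λ l → 1 ≤ l × l ≤ k) L →
    (∃ λ c → IsExpansion n k c) ×
    ((c : Vec ℕ n → ℤ) → IsExpansion n k c →
      ((+ prodℕ (Vec.map _! L)) ℤ.* c L ≡ + numRankingTables k L)
      × (prodℕ L < k → c L ≡ + 0)
      × (k ≤ prodℕ L → + 0 ℤ.< c L))
mainTheorem10 (suc n) k L _ _ L-bounds =
  (coeff (expansion-fall-prod (suc n) k) , expands (expansion-fall-prod (suc n) k)) ,
  λ c expansion →
    let tables = coefficient-counts-tables c expansion {L} (VecAll.map proj₂ L-bounds) in
    tables ,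
    (λ ∏L<k → pos-*-≡0 (prodℕ (Vec.map _! L)) {{prod-factorials≢0 L}}
                 (trans tables (cong +_ (numRankingTables-vanish {L = L} ∏L<k)))) ,
    (λ k≤∏L → pos-*-pos (prodℕ (Vec.map _! L)) tables (numRankingTables-positive {L = L} L-bounds k≤∏L))
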